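{- Let $SO(G)=\sum_{uv\in E(G)}\sqrt{d_u^2+d_v^2}$ be the Sombor index of a finite simple graph $G$ ($d_w$ the degree of $w$). Then no finite simple graph $G$ has $SO(G)\in\{1,2,\dots,59\}$, and there is a graph with Sombor index $60$ (namely $K_{3,4}$). In other words, the smallest positive integer that is the Sombor index of a graph is $60$.
   Context: All graphs are finite and simple; $K_{3,4}$ is the complete bipartite graph with parts of sizes $3$ and $4$. -}

module Defs where

open import Level using (Level; _⊔_) renaming (suc to lsuc)
open import Algebra.Bundles using (CommutativeRing)
open import Relation.Binary.Structures using (IsStrictTotalOrder)
open import Relation.Nullary using (¬_)
open import Relation.Binary.PropositionalEquality using (_≡_)
open import Data.Product using (∃)
open import Data.Sum using (_⊎_)
open import Data.Bool using (Bool; true; false; if_then_else_; _xor_)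
open import Data.Bool.Properties using (xor-comm; xor-same)
open import Data.Nat as ℕ using (ℕ; zero; suc; _<ᵇ_)
open import Data.Fin using (Fin; toℕ)
open import Data.List using (List; map; foldr; filter; allFin; concatMap)

-- Euclidean fields: ordered fields in which every non-negative element
-- has a (non-negative) square root.  ℝ is one; the Sombor index is
-- evaluated in an arbitrary such field.

record EuclideanField (c ℓ : Level) : Set (lsuc (c ⊔ ℓ)) where
  field
    commRing : CommutativeRing c ℓ
  open CommutativeRing commRing public
  field
    _<_                  : Carrier → Carrier → Set ℓ
    <-isStrictTotalOrder : IsStrictTotalOrder _≈_ _<_
    0<1                  : 0# < 1#
    +-mono-<             : ∀ {x y} z → x < y → (x + z) < (y + z)
    *-pos                : ∀ {x y} → 0# < x → 0# < y → 0# < (x * y)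
    inverse              : ∀ x → ¬ (x ≈ 0#) → ∃ λ y → (x * y) ≈ 1#

  _≤_ : Carrier → Carrier → Set ℓ
  x ≤ y = x < y ⊎ x ≈ y

  field
    sqrt        : Carrier → Carrier
    sqrt-nonneg : ∀ x → 0# ≤ sqrt x
    sqrt-sq     : ∀ x → 0# ≤ x → (sqrt x * sqrt x) ≈ x

  ι : ℕ → Carrier
  ι zero    = 0#
  ι (suc n) = 1# + ι n

  Σ : List Carrier → Carrier
  Σ = foldr _+_ 0#

record Graph (n : ℕ) : Set where
  field
    adj    : Fin n → Fin n → Bool
    sym    : ∀ i j → adj i j ≡ adj j i
    irrefl : ∀ i → adj i i ≡ false

open Graph public

degree : ∀ {n} → Graph n → Fin n → ℕ
degree {n} G i = foldr ℕ._+_ 0 (map (λ j → if adj G i j then 1 else 0) (allFin n))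

SO : ∀ {c ℓ} (F : EuclideanField c ℓ) {n} → Graph n → EuclideanField.Carrier F
SO F {n} G = Σ (concatMap (λ i → concatMap (λ j → edgeTerm i j) (allFin n)) (allFin n))
  where
  open EuclideanField F
  sq : ℕ → ℕ
  sq d = d ℕ.* d
  edgeTerm : Fin n → Fin n → List Carrier
  edgeTerm i j = if (toℕ i <ᵇ toℕ j) then (if adj G i j
                   then sqrt (ι (sq (degree G i) ℕ.+ sq (degree G j))) Data.List.∷ Data.List.[]
                   else Data.List.[]) else Data.List.[]

-- K_{3,4} on Fin 7: parts {0,1,2} and {3,4,5,6}

K34 : Graph 7
K34 = record
  { adj    = λ i j → (toℕ i <ᵇ 3) xor (toℕ j <ᵇ 3)
  ; sym    = λ i j → xor-comm (toℕ i <ᵇ 3) (toℕ j <ᵇ 3)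
  ; irrefl = λ i → xor-same (toℕ i <ᵇ 3)
  }

-- If SO(G) is an integer k, then every edge term √(d_u² + d_v²) is an integer: if a sum of
-- square roots of naturals is an integer, each of them is a perfect square.  This is the linear
-- independence of square roots of square-free numbers, proved inside an arbitrary Euclidean field
-- by the classical simultaneous induction showing that ℚ(√q₁, …, √qₘ) is a field not containing
-- √(p₁⋯pₖ) for distinct primes pᵢ outside {q₁, …, qₘ}.  So each edge uv has an integer
-- hypotenuse r > d_u, d_v, and counting the edges at a vertex of degree d gives d(d + 1) ≤ k.
-- For k ≤ 59 all degrees are then at most 7, where the only Pythagorean pair of legs is (3, 4):
-- every edge contributes 5 and has exactly one endpoint of degree 3 and one of degree 4.
-- Counting the E edges from either class, 3 ∣ E and 4 ∣ E, so 12 ∣ E and 60 ∣ k.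
-- In K_{3,4} all 12 edges contribute 5.

module Submission where

open import Defs
open import Data.Nat using (ℕ; _≤_)
open import Data.Product using (_×_)
open import Relation.Nullary using (¬_)

module SquarefreeParts where
  open import Data.Product using (_,_; proj₁; ∃)
  open import Relation.Binary.PropositionalEquality as ≡ using (_≡_; _≢_; refl; trans; cong; subst; module ≡-Reasoning)
  open import Data.Nat using (zero; suc; _*_; _<_; _≟_; ≢-nonZero; nonTrivial⇒n>1)
  open import Data.Nat.Properties
  open import Data.Nat.Divisibility using (_∣_; _∤_; divides)
  open import Data.Nat.Primality using (Prime; euclidsLemma; prime⇒nonZero; prime⇒nonTrivial)
  open import Data.Nat.Primality.Factorisation using (factorise; PrimeFactorisation; factorisationHasAllPrimeFactors)
  open import Data.Nat.ListAction using (product)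
  open import Data.Nat.ListAction.Properties using (∈⇒≤product)
  open import Data.Nat.Tactic.RingSolver using (solve-∀)
  open import Data.List using (List; []; _∷_; filter)
  open import Data.List.Properties using (filter-accept; filter-reject; filter-all)
  open import Data.List.Membership.Propositional using (_∈_; _∉_)
  open import Data.List.Membership.Propositional.Properties using (∈-filter⁻)
  open import Data.List.Membership.DecPropositional _≟_ using (_∈?_)
  open import Data.List.Relation.Unary.All as All using (All; []; _∷_)
  open import Data.List.Relation.Unary.All.Properties using (¬Any⇒All¬)
  open import Data.List.Relation.Unary.Any using (here; there)
  open import Data.List.Relation.Unary.Unique.Propositional using (Unique; []; _∷_)
  open import Data.List.Relation.Unary.Unique.Propositional.Properties using (filter⁺)
  open import Data.Sum using (inj₁; inj₂; [_,_]′)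
  open import Data.Empty using (⊥-elim)
  open import Induction.WellFounded using (Acc; acc)
  open import Data.Nat.Induction using (<-wellFounded)
  open import Algebra.Properties.CommutativeSemigroup *-commutativeSemigroup using (x∙yz≈y∙xz)
  open import Relation.Nullary using (Dec; yes; no; ¬?)
  open import Function using (id; _∘_)

  IsSquare : ℕ → Set
  IsSquare w = ∃ λ s → s * s ≡ w

  prime∣square⇒prime∣root : ∀ {p} d → Prime p → p ∣ d * d → p ∣ d
  prime∣square⇒prime∣root d pp p∣d² = [ id , id ]′ (euclidsLemma d d pp p∣d²)

  private
    [pr]b²≡[rb²]p : ∀ p r b → p * r * (b * b) ≡ r * (b * b) * p
    [pr]b²≡[rb²]p = solve-∀
    [dp]²≡p[d²p] : ∀ p d → (d * p) * (d * p) ≡ p * (d * d * p)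
    [dp]²≡p[d²p] = solve-∀
    p[[pr]b²]≡r[bp]² : ∀ p r b → p * (p * r * (b * b)) ≡ r * ((b * p) * (b * p))
    p[[pr]b²]≡r[bp]² = solve-∀

  p*r*b²≡d²⇒p∣d : ∀ {p r} b d → Prime p → p * r * (b * b) ≡ d * d → ∃ λ d′ → r * (b * b) ≡ d′ * d′ * p
  p*r*b²≡d²⇒p∣d {p} {r} b d pp eq with prime∣square⇒prime∣root d pp (divides (r * (b * b)) (trans (≡.sym eq) ([pr]b²≡[rb²]p p r b)))
  ... | divides d′ refl = d′ , *-cancelˡ-≡ _ _ p {{prime⇒nonZero pp}} (begin
    p * (r * (b * b))     ≡⟨ *-assoc p r (b * b) ⟨
    p * r * (b * b)       ≡⟨ eq ⟩
    (d′ * p) * (d′ * p)   ≡⟨ [dp]²≡p[d²p] p d′ ⟩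
    p * (d′ * d′ * p)     ∎)
    where open ≡-Reasoning

  r*b²≡d²*p⇒p∣b : ∀ {p r} b d′ → Prime p → p ∤ r → r * (b * b) ≡ d′ * d′ * p →
          ∃ λ b′ → b ≡ b′ * p × p * r * (b′ * b′) ≡ d′ * d′
  r*b²≡d²*p⇒p∣b {p} {r} b d′ pp p∤r eq with euclidsLemma r (b * b) pp (divides (d′ * d′) eq)
  ... | inj₁ p∣r = ⊥-elim (p∤r p∣r)
  ... | inj₂ p∣b² with prime∣square⇒prime∣root b pp p∣b²
  ...   | divides b′ refl = b′ , refl , *-cancelˡ-≡ _ _ p {{prime⇒nonZero pp}} (begin
    p * (p * r * (b′ * b′))       ≡⟨ p[[pr]b²]≡r[bp]² p r b′ ⟩
    r * ((b′ * p) * (b′ * p))     ≡⟨ eq ⟩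
    d′ * d′ * p                   ≡⟨ *-comm (d′ * d′) p ⟩
    p * (d′ * d′)                 ∎)
    where open ≡-Reasoning

  -- Infinite descent: p ∣ d, then p ∣ b, and dividing both by p gives a smaller solution.
  p*r*b²≢square : ∀ {p r} b d → Prime p → p ∤ r → b ≢ 0 → p * r * (b * b) ≢ d * d
  p*r*b²≢square {p} {r} b d pp p∤r = go b (<-wellFounded b) d
    where
    go : ∀ b → Acc _<_ b → ∀ d → b ≢ 0 → p * r * (b * b) ≢ d * d
    go b (acc smaller) d b≢0 eq with p*r*b²≡d²⇒p∣d b d pp eq
    ... | d′ , eq′ with r*b²≡d²*p⇒p∣b b d′ pp p∤r eq′
    ...   | b′ , refl , eq″ = go b′ (smaller b′<b′p) d′ b′≢0 eq″
      where
      b′≢0 : b′ ≢ 0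
      b′≢0 refl = b≢0 refl
      b′<b′p : b′ < b′ * p
      b′<b′p = m<m*n b′ p {{≢-nonZero b′≢0}} (nonTrivial⇒n>1 p {{prime⇒nonTrivial pp}})

  squarefree*square≢square : ∀ {p ps} b d → All Prime (p ∷ ps) → p ∉ ps → b ≢ 0 → product (p ∷ ps) * (b * b) ≢ d * d
  squarefree*square≢square b d (pp ∷ ps-prime) p∉ps =
    p*r*b²≢square b d pp (p∉ps ∘ λ p∣∏ps → factorisationHasAllPrimeFactors pp p∣∏ps ps-prime)

  record SquarefreeForm (w : ℕ) (P : ℕ → Set) : Set where
    field
      root : ℕ
      core : List ℕ
      w≡root²*∏core : w ≡ root * root * product core
      unique : Unique core
      allP : All P core

  _≢?_ : ∀ m n → Dec (m ≢ n)
  m ≢? n = ¬? (m ≟ n)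

  remove : ℕ → List ℕ → List ℕ
  remove p = filter (p ≢?_)

  product-remove : ∀ {p ps} → p ∈ ps → Unique ps → product ps ≡ p * product (remove p ps)
  product-remove {p} {x ∷ ps} (here refl) (p∉ps ∷ _)
    rewrite filter-reject (p ≢?_) {x = p} {xs = ps} (λ p≢p → p≢p refl)
          | filter-all (p ≢?_) p∉ps = refl
  product-remove {p} {x ∷ ps} (there p∈ps) (x∉ps ∷ uniq)
    rewrite filter-accept (p ≢?_) {x = x} {xs = ps} (λ { refl → All.lookup x∉ps p∈ps refl })
          | product-remove p∈ps uniq = x∙yz≈y∙xz x p (product (remove p ps))

  private
    p[s²[pr]]≡[ps]²r : ∀ p s r → p * (s * s * (p * r)) ≡ p * s * (p * s) * r
    p[s²[pr]]≡[ps]²r = solve-∀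
    p[s²r]≡s²[pr] : ∀ p s r → p * (s * s * r) ≡ s * s * (p * r)
    p[s²r]≡s²[pr] = solve-∀

  -- Equal primes of a factor list are paired off into the root.
  pairUp : ∀ xs → SquarefreeForm (product xs) (_∈ xs)
  pairUp [] = record { root = 1 ; core = [] ; w≡root²*∏core = refl ; unique = [] ; allP = [] }
  pairUp (p ∷ xs) with pairUp xs
  ... | record { root = s ; core = ps ; w≡root²*∏core = eq ; unique = uniq ; allP = ps⊆xs } with p ∈? ps
  ...   | yes p∈ps = record
          { root = p * s
          ; core = remove p ps
          ; w≡root²*∏core = trans (cong (p *_) (trans eq (cong (s * s *_) (product-remove p∈ps uniq)))) (p[s²[pr]]≡[ps]²r p s _)
          ; unique = filter⁺ (p ≢?_) uniq
          ; allP = All.tabulate (λ q∈ → there (All.lookup ps⊆xs (proj₁ (∈-filter⁻ (p ≢?_) q∈))))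
          }
  ...   | no p∉ps = record
          { root = s
          ; core = p ∷ ps
          ; w≡root²*∏core = trans (cong (p *_) eq) (p[s²r]≡s²[pr] p s (product ps))
          ; unique = ¬Any⇒All¬ ps p∉ps ∷ uniq
          ; allP = here refl ∷ All.map there ps⊆xs
          }

  squarefreeForm : ∀ w → SquarefreeForm w (λ q → Prime q × q ≤ w)
  squarefreeForm zero = record { root = 0 ; core = [] ; w≡root²*∏core = refl ; unique = [] ; allP = [] }
  squarefreeForm w@(suc _) = record
    { root = root
    ; core = core
    ; w≡root²*∏core = trans isFactorisation w≡root²*∏core
    ; unique = unique
    ; allP = All.map (λ q∈ → All.lookup factorsPrime q∈ , q≤w q∈) allP
    }
    where
    open PrimeFactorisation (factorise w)
    open SquarefreeForm (pairUp factors)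
    q≤w : ∀ {q} → q ∈ factors → q ≤ w
    q≤w q∈ = subst (_ ≤_) (≡.sym isFactorisation) (∈⇒≤product (All.map prime⇒nonZero factorsPrime) q∈)

module FinSums where
  open import Data.Bool using (Bool; if_then_else_)
  open import Relation.Binary.PropositionalEquality using (_≡_; _≢_; refl; trans; cong; subst)
  open import Data.Nat using (zero; suc; _+_)
  open import Data.Nat.Properties using (+-mono-≤; ≤-trans; m≤m+n; m≤n+m; +-*-semiring; +-commutativeSemigroup)
  open import Data.Fin using (Fin) renaming (zero to fzero; suc to fsuc)
  open import Data.Fin.Properties using (suc-injective)
  open import Data.List using (List; []; _∷_; map; tabulate; allFin; concatMap)
  open import Data.List.Properties using (map-tabulate)
  open import Data.Nat.ListAction as List using ()
  open import Data.Nat.ListAction.Properties using (sum-++)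
  open import Algebra.Properties.Semiring.Sum +-*-semiring public
    using (sum; sum-syntax; ∑-distrib-+; ∑-comm; *-distribˡ-sum; sum-cong-≗)
  open import Function using (_∘_)
  open import Algebra.Properties.CommutativeSemigroup +-commutativeSemigroup using (x∙yz≈y∙xz)

  𝟙 : Bool → ℕ
  𝟙 b = if b then 1 else 0

  sum-tabulate : ∀ {n} (f : Fin n → ℕ) → List.sum (tabulate f) ≡ sum f
  sum-tabulate {zero} f = refl
  sum-tabulate {suc n} f = cong (f fzero +_) (sum-tabulate (f ∘ fsuc))

  sum-map-allFin : ∀ {n} (f : Fin n → ℕ) → List.sum (map f (allFin n)) ≡ sum f
  sum-map-allFin f = trans (cong List.sum (map-tabulate (λ i → i) f)) (sum-tabulate f)

  sum-concatMap : ∀ {a} {A : Set a} (g : A → List ℕ) xs → List.sum (concatMap g xs) ≡ List.sum (map (List.sum ∘ g) xs)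
  sum-concatMap g [] = refl
  sum-concatMap g (x ∷ xs) = trans (sum-++ (g x) (concatMap g xs)) (cong (List.sum (g x) +_) (sum-concatMap g xs))

  ∑∑-distrib-+ : ∀ {m n} (f g : Fin m → Fin n → ℕ) →
                 ∑[ i < m ] ∑[ j < n ] (f i j + g i j) ≡ ∑[ i < m ] ∑[ j < n ] f i j + ∑[ i < m ] ∑[ j < n ] g i j
  ∑∑-distrib-+ f g = trans (sum-cong-≗ λ i → ∑-distrib-+ (f i) (g i))
                           (∑-distrib-+ (λ i → ∑[ j < _ ] f i j) (λ i → ∑[ j < _ ] g i j))

  ∑-mono-≤ : ∀ {n} {f g : Fin n → ℕ} → (∀ i → f i ≤ g i) → sum f ≤ sum g
  ∑-mono-≤ {zero} f≤g = Data.Nat.z≤n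
  ∑-mono-≤ {suc n} f≤g = +-mono-≤ (f≤g fzero) (∑-mono-≤ (f≤g ∘ fsuc))

  term≤∑ : ∀ {n} (f : Fin n → ℕ) i → f i ≤ sum f
  term≤∑ f fzero = m≤m+n _ _
  term≤∑ f (fsuc i) = ≤-trans (term≤∑ (f ∘ fsuc) i) (m≤n+m _ _)

  term+∑≤∑ : ∀ {n} (f g : Fin n → ℕ) i {x} → x ≤ f i → g i ≡ 0 → (∀ j → j ≢ i → g j ≤ f j) → x + sum g ≤ sum f
  term+∑≤∑ f g fzero x≤ gi≡0 g≤f rewrite gi≡0 = +-mono-≤ x≤ (∑-mono-≤ (λ j → g≤f (fsuc j) λ ()))
  term+∑≤∑ f g (fsuc i) {x} x≤ gi≡0 g≤f =
    subst (_≤ sum f) (x∙yz≈y∙xz (g fzero) x _)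
      (+-mono-≤ (g≤f fzero λ ()) (term+∑≤∑ (f ∘ fsuc) (g ∘ fsuc) i x≤ gi≡0 (λ j j≢i → g≤f (fsuc j) (j≢i ∘ suc-injective))))

module EdgeSums {n : ℕ} (G : Graph n) where
  open import Data.Product using (_,_)
  open import Relation.Binary.PropositionalEquality as ≡ using (_≡_; refl; trans; cong; subst; module ≡-Reasoning)
  open FinSums
  open import Data.Nat using (_+_; _*_; _<_; _<ᵇ_; _≡ᵇ_)
  open import Data.Nat.Properties
  open import Data.Nat.Divisibility using (_∣_; divides)
  open import Data.Bool using (Bool; true; false; if_then_else_)
  open import Data.Fin using (Fin; toℕ)
  open import Data.Fin.Properties using (toℕ-injective)
  open import Data.List using (List; []; _∷_; map; allFin; concatMap)
  open import Data.List.Properties using (map-concatMap; concatMap-cong)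
  open import Data.List.Relation.Unary.All using (All; _∷_)
  open import Data.List.Relation.Unary.All.Properties using (concat⁻; map⁻; tabulate⁻)
  open import Data.Nat.ListAction as List using ()
  open import Relation.Binary.Definitions using (tri<; tri≈; tri>)
  open import Algebra.Properties.CommutativeSemigroup *-commutativeSemigroup using (x∙yz≈y∙xz)
  open import Data.Bool.Properties using (T-≡)
  open import Data.Sum using (_⊎_; inj₁; inj₂)
  open import Function using (Equivalence; _∘_)
  open import Relation.Nullary using (contradiction)

  below : Fin n → Fin n → Bool
  below i j = toℕ i <ᵇ toℕ j

  -- Each edge {i, j} of G is counted once, as the arc from the smaller vertex to the larger.
  IsArc : Fin n → Fin n → Set
  IsArc i j = below i j ≡ true × adj G i j ≡ true

  arc : Fin n → Fin n → ℕ
  arc i j = if below i j then 𝟙 (adj G i j) else 0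

  edgeSum : (Fin n → Fin n → ℕ) → ℕ
  edgeSum f = ∑[ i < n ] ∑[ j < n ] (arc i j * f i j)

  edgeCount : ℕ
  edgeCount = edgeSum (λ _ _ → 1)

  -- Laid out exactly as the sum defining SO, so that SO is definitionally a sum over an edgeList.
  arcValues : ∀ {a} {A : Set a} → Fin n → Fin n → A → List A
  arcValues i j x = if below i j then (if adj G i j then x ∷ [] else []) else []

  edgeList : ∀ {a} {A : Set a} → (Fin n → Fin n → A) → List A
  edgeList f = concatMap (λ i → concatMap (λ j → arcValues i j (f i j)) (allFin n)) (allFin n)

  degree≡∑adj : ∀ i → degree G i ≡ ∑[ j < n ] 𝟙 (adj G i j)
  degree≡∑adj i = sum-map-allFin (λ j → 𝟙 (adj G i j))

  adj⇒degree≥1 : ∀ {i j} → adj G i j ≡ true → 1 ≤ degree G i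
  adj⇒degree≥1 {i} {j} adj≡true =
    subst (_≤ degree G i) (cong 𝟙 adj≡true) (subst (𝟙 (adj G i j) ≤_) (≡.sym (degree≡∑adj i)) (term≤∑ _ j))

  below≡true : ∀ {i j} → toℕ i < toℕ j → below i j ≡ true
  below≡true i<j = Equivalence.to T-≡ (<⇒<ᵇ i<j)

  below≡false : ∀ {i j} → ¬ toℕ i < toℕ j → below i j ≡ false
  below≡false {i} {j} i≮j with below i j in eq
  ... | false = refl
  ... | true = contradiction (<ᵇ⇒< (toℕ i) (toℕ j) (Equivalence.from T-≡ eq)) i≮j

  adj≡arc+arcᵀ : ∀ i j → 𝟙 (adj G i j) ≡ arc i j + arc j i
  adj≡arc+arcᵀ i j with <-cmp (toℕ i) (toℕ j)
  ... | tri< i<j _ j≮i rewrite below≡true {i} {j} i<j | below≡false {j} {i} j≮i = ≡.sym (+-identityʳ _)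
  ... | tri> i≮j _ j<i rewrite below≡true {j} {i} j<i | below≡false {i} {j} i≮j | Graph.sym G i j = refl
  ... | tri≈ i≮j i≡j j≮i rewrite below≡false {i} {j} i≮j | below≡false {j} {i} j≮i | toℕ-injective i≡j | Graph.irrefl G j = refl

  arc-cases : ∀ i j → (IsArc i j × arc i j ≡ 1) ⊎ arc i j ≡ 0
  arc-cases i j with below i j | adj G i j
  ... | true | true = inj₁ ((refl , refl) , refl)
  ... | true | false = inj₂ refl
  ... | false | _ = inj₂ refl

  arc-irrefl : ∀ i → arc i i ≡ 0
  arc-irrefl i rewrite below≡false {i} {i} (<-irrefl refl) = refl

  edgeSum-cong : ∀ {f g} → (∀ i j → IsArc i j → f i j ≡ g i j) → edgeSum f ≡ edgeSum g
  edgeSum-cong {f} {g} f≡g = sum-cong-≗ λ i → sum-cong-≗ λ j → on-arc i j (arc-cases i j)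
    where
    on-arc : ∀ i j → (IsArc i j × arc i j ≡ 1) ⊎ arc i j ≡ 0 → arc i j * f i j ≡ arc i j * g i j
    on-arc i j (inj₁ (ij , a≡1)) = cong (arc i j *_) (f≡g i j ij)
    on-arc i j (inj₂ a≡0) rewrite a≡0 = refl

  edgeSum-scale : ∀ c f → edgeSum (λ i j → c * f i j) ≡ c * edgeSum f
  edgeSum-scale c f = begin
    ∑[ i < n ] ∑[ j < n ] (arc i j * (c * f i j)) ≡⟨ sum-cong-≗ (λ i → sum-cong-≗ λ j → x∙yz≈y∙xz (arc i j) c (f i j)) ⟩
    ∑[ i < n ] ∑[ j < n ] (c * (arc i j * f i j)) ≡⟨ sum-cong-≗ (λ i → *-distribˡ-sum c (λ j → arc i j * f i j)) ⟨
    ∑[ i < n ] (c * ∑[ j < n ] (arc i j * f i j)) ≡⟨ *-distribˡ-sum c (λ i → ∑[ j < n ] (arc i j * f i j)) ⟨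
    c * edgeSum f                                   ∎
    where open ≡-Reasoning

  handshake : ∀ (g : Fin n → ℕ) → ∑[ i < n ] (g i * degree G i) ≡ edgeSum (λ i j → g i + g j)
  handshake g = begin
    ∑[ i < n ] (g i * degree G i)
      ≡⟨ sum-cong-≗ (λ i → trans (cong (g i *_) (degree≡∑adj i)) (*-distribˡ-sum (g i) (λ j → 𝟙 (adj G i j)))) ⟩
    ∑[ i < n ] ∑[ j < n ] (g i * 𝟙 (adj G i j))
      ≡⟨ sum-cong-≗ (λ i → sum-cong-≗ λ j → trans (cong (g i *_) (adj≡arc+arcᵀ i j)) (*-distribˡ-+ (g i) _ _)) ⟩
    ∑[ i < n ] ∑[ j < n ] (g i * arc i j + g i * arc j i)
      ≡⟨ ∑∑-distrib-+ (λ i j → g i * arc i j) (λ i j → g i * arc j i) ⟩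
    ∑[ i < n ] ∑[ j < n ] (g i * arc i j) + ∑[ i < n ] ∑[ j < n ] (g i * arc j i)
      ≡⟨ cong (∑[ i < n ] ∑[ j < n ] (g i * arc i j) +_) (∑-comm (λ i j → g i * arc j i)) ⟩
    ∑[ i < n ] ∑[ j < n ] (g i * arc i j) + ∑[ i < n ] ∑[ j < n ] (g j * arc i j)
      ≡⟨ ∑∑-distrib-+ (λ i j → g i * arc i j) (λ i j → g j * arc i j) ⟨
    ∑[ i < n ] ∑[ j < n ] (g i * arc i j + g j * arc i j)
      ≡⟨ sum-cong-≗ (λ i → sum-cong-≗ λ j → trans (≡.sym (*-distribʳ-+ (arc i j) (g i) (g j))) (*-comm _ (arc i j))) ⟩
    edgeSum (λ i j → g i + g j) ∎
    where open ≡-Reasoning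

  incident≤edgeSum : ∀ (f : Fin n → Fin n → ℕ) → (∀ i j → f i j ≡ f j i) → ∀ i →
                     ∑[ j < n ] (𝟙 (adj G i j) * f i j) ≤ edgeSum f
  incident≤edgeSum f f-sym i = subst (_≤ edgeSum f) (≡.sym row+column)
    (term+∑≤∑ (λ a → ∑[ b < n ] M a b) (λ a → M a i) i ≤-refl (cong (_* f i i) (arc-irrefl i)) (λ a _ → term≤∑ (M a) i))
    where
    M : Fin n → Fin n → ℕ
    M a b = arc a b * f a b
    row+column : ∑[ j < n ] (𝟙 (adj G i j) * f i j) ≡ ∑[ j < n ] M i j + ∑[ j < n ] M j i
    row+column = trans (sum-cong-≗ λ j → trans (cong (_* f i j) (adj≡arc+arcᵀ i j))
                                        (trans (*-distribʳ-+ (f i j) (arc i j) (arc j i)) (cong (λ x → M i j + arc j i * x) (f-sym i j))))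
                       (∑-distrib-+ (M i) (λ j → M j i))

  𝟙≡ᵇ*x≡c*𝟙≡ᵇ : ∀ x c → 𝟙 (x ≡ᵇ c) * x ≡ c * 𝟙 (x ≡ᵇ c)
  𝟙≡ᵇ*x≡c*𝟙≡ᵇ x c with x ≡ᵇ c in eq
  ... | true rewrite ≡ᵇ⇒≡ x c (Equivalence.from T-≡ eq) = trans (+-identityʳ c) (≡.sym (*-identityʳ c))
  ... | false = ≡.sym (*-zeroʳ c)

  degree-class-divides : ∀ c → (∀ i j → IsArc i j → 𝟙 (degree G i ≡ᵇ c) + 𝟙 (degree G j ≡ᵇ c) ≡ 1) → c ∣ edgeCount
  degree-class-divides c one-endpoint = divides (∑[ i < n ] g i) (begin
    edgeCount                              ≡⟨ edgeSum-cong (λ i j ij → ≡.sym (one-endpoint i j ij)) ⟩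
    edgeSum (λ i j → g i + g j)            ≡⟨ handshake g ⟨
    ∑[ i < n ] (g i * degree G i)          ≡⟨ sum-cong-≗ (λ i → 𝟙≡ᵇ*x≡c*𝟙≡ᵇ (degree G i) c) ⟩
    ∑[ i < n ] (c * g i)                   ≡⟨ *-distribˡ-sum c g ⟨
    c * ∑[ i < n ] g i                     ≡⟨ *-comm c _ ⟩
    (∑[ i < n ] g i) * c                   ∎)
    where
    open ≡-Reasoning
    g : Fin n → ℕ
    g i = 𝟙 (degree G i ≡ᵇ c)

  sum-edgeList : ∀ f → List.sum (edgeList f) ≡ edgeSum f
  sum-edgeList f = begin
    List.sum (edgeList f)
      ≡⟨ trans (sum-concatMap row (allFin n)) (sum-map-allFin (List.sum ∘ row)) ⟩
    ∑[ i < n ] List.sum (row i)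
      ≡⟨ sum-cong-≗ (λ i → trans (sum-concatMap (λ j → arcValues i j (f i j)) (allFin n))
                                 (sum-map-allFin (λ j → List.sum (arcValues i j (f i j))))) ⟩
    ∑[ i < n ] ∑[ j < n ] List.sum (arcValues i j (f i j))
      ≡⟨ sum-cong-≗ (λ i → sum-cong-≗ λ j → sum-arcValues i j (f i j)) ⟩
    edgeSum f ∎
    where
    open ≡-Reasoning
    row : Fin n → List ℕ
    row i = concatMap (λ j → arcValues i j (f i j)) (allFin n)
    sum-arcValues : ∀ i j x → List.sum (arcValues i j x) ≡ arc i j * x
    sum-arcValues i j x with below i j | adj G i j
    ... | true | true = refl
    ... | true | false = refl
    ... | false | _ = refl

  map-edgeList : ∀ {a b} {A : Set a} {B : Set b} (h : A → B) f → map h (edgeList f) ≡ edgeList (λ i j → h (f i j))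
  map-edgeList h f = trans (map-concatMap h _ (allFin n)) (concatMap-cong (λ i →
                       trans (map-concatMap h _ (allFin n)) (concatMap-cong (λ j → map-arcValues i j (f i j)) (allFin n))) (allFin n))
    where
    map-arcValues : ∀ i j x → map h (arcValues i j x) ≡ arcValues i j (h x)
    map-arcValues i j x with below i j | adj G i j
    ... | true | true = refl
    ... | true | false = refl
    ... | false | _ = refl

  All-edgeList⁻ : ∀ {a p} {A : Set a} {P : A → Set p} f → All P (edgeList f) → ∀ i j → IsArc i j → P (f i j)
  All-edgeList⁻ {P = P} f all i j (b , a) = on-arc (tabulate⁻ (map⁻ (concat⁻ (tabulate⁻ (map⁻ (concat⁻ all)) i))) j)
    where
    on-arc : All P (arcValues i j (f i j)) → P (f i j)
    on-arc rewrite b | a = λ { (px ∷ _) → px }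

module PythagoreanArithmetic where
  open import Data.Product using (_,_; ∃)
  open import Relation.Binary.PropositionalEquality as ≡ using (_≡_; refl; subst; subst₂)
  open SquarefreeParts using (IsSquare)
  open FinSums using (𝟙)
  open import Data.Nat using (zero; suc; _+_; _*_; _<_; _≟_; _≤?_; _≡ᵇ_; z≤n; s≤s)
  open import Data.Nat.Properties
  open import Data.Nat.Divisibility using (_∣_; divides)
  open import Data.Nat.Coprimality using (Coprime; coprime?; coprime-divisor)
  open import Data.Fin using (Fin; toℕ; fromℕ<)
  open import Data.Fin.Properties using (any?; all?; toℕ-fromℕ<)
  open import Data.Sum using (_⊎_; inj₁; inj₂)
  open import Relation.Nullary using (Dec; yes; no; contradiction)
  open import Relation.Nullary.Decidable using (from-yes; map′; _×-dec_; _⊎-dec_; _→-dec_)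

  s≤s*s : ∀ s → s ≤ s * s
  s≤s*s zero = z≤n
  s≤s*s (suc s) = m≤m*n (suc s) (suc s)

  isSquare? : ∀ w → Dec (IsSquare w)
  isSquare? w = map′ from to (any? λ s → toℕ s * toℕ s ≟ w)
    where
    from : ∃ (λ (s : Fin (suc w)) → toℕ s * toℕ s ≡ w) → IsSquare w
    from (s , s²≡w) = toℕ s , s²≡w
    to : IsSquare w → ∃ λ (s : Fin (suc w)) → toℕ s * toℕ s ≡ w
    to (s , s²≡w) = fromℕ< s<1+w , subst (λ t → t * t ≡ w) (≡.sym (toℕ-fromℕ< s<1+w)) s²≡w
      where s<1+w = s≤s (subst (s ≤_) s²≡w (s≤s*s s))

  -- The integer square root of a perfect square, and 0 on non-squares.
  √ₙ : ℕ → ℕ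
  √ₙ w with isSquare? w
  ... | yes (s , _) = s
  ... | no _ = 0

  √ₙ-square : ∀ {w} → IsSquare w → √ₙ w * √ₙ w ≡ w
  √ₙ-square {w} sq with isSquare? w
  ... | yes (s , s²≡w) = s²≡w
  ... | no ¬sq = contradiction sq ¬sq

  leg<hypotenuse : ∀ {r a b} → r * r ≡ a * a + b * b → 1 ≤ b → a < r
  leg<hypotenuse {r} {a} {b} eq 1≤b with a <? r
  ... | yes a<r = a<r
  ... | no a≮r = contradiction (≤-trans (m<m+n (a * a) (*-mono-≤ 1≤b 1≤b)) (subst (_≤ a * a) eq (*-mono-≤ r≤a r≤a))) (<-irrefl refl)
    where r≤a = ≮⇒≥ a≮r

  Legs3-4 : ℕ → ℕ → Set
  Legs3-4 a b = (a ≡ 3 × b ≡ 4) ⊎ (a ≡ 4 × b ≡ 3)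

  private
    SmallTriple : ℕ → ℕ → Set
    SmallTriple a b = 1 ≤ a → 1 ≤ b → IsSquare (a * a + b * b) → Legs3-4 a b

    smallTriple? : ∀ a b → Dec (SmallTriple a b)
    smallTriple? a b = (1 ≤? a) →-dec ((1 ≤? b) →-dec (isSquare? (a * a + b * b) →-dec
                         (((a ≟ 3) ×-dec (b ≟ 4)) ⊎-dec ((a ≟ 4) ×-dec (b ≟ 3)))))

    smallTriples : ∀ (a b : Fin 8) → SmallTriple (toℕ a) (toℕ b)
    smallTriples = from-yes (all? {n = 8} λ a → all? {n = 8} λ b → smallTriple? (toℕ a) (toℕ b))

  pythagorean-legs≤7 : ∀ {a b} → a ≤ 7 → b ≤ 7 → 1 ≤ a → 1 ≤ b → IsSquare (a * a + b * b) → Legs3-4 a b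
  pythagorean-legs≤7 {a} {b} a≤7 b≤7 = subst₂ SmallTriple (toℕ-fromℕ< (s≤s a≤7)) (toℕ-fromℕ< (s≤s b≤7))
    (smallTriples (fromℕ< (s≤s a≤7)) (fromℕ< (s≤s b≤7)))

  legs3-4⇒hypotenuse≡5 : ∀ {a b} → Legs3-4 a b → √ₙ (a * a + b * b) ≡ 5
  legs3-4⇒hypotenuse≡5 (inj₁ (refl , refl)) = refl
  legs3-4⇒hypotenuse≡5 (inj₂ (refl , refl)) = refl

  legs3-4⇒one-leg-is : ∀ {a b c} → Legs3-4 a b → c ≡ 3 ⊎ c ≡ 4 → 𝟙 (a ≡ᵇ c) + 𝟙 (b ≡ᵇ c) ≡ 1
  legs3-4⇒one-leg-is (inj₁ (refl , refl)) (inj₁ refl) = refl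
  legs3-4⇒one-leg-is (inj₁ (refl , refl)) (inj₂ refl) = refl
  legs3-4⇒one-leg-is (inj₂ (refl , refl)) (inj₁ refl) = refl
  legs3-4⇒one-leg-is (inj₂ (refl , refl)) (inj₂ refl) = refl

  n*[1+n]≤59⇒n≤7 : ∀ {n} → n * suc n ≤ 59 → n ≤ 7
  n*[1+n]≤59⇒n≤7 {n} bound with n ≤? 7
  ... | yes n≤7 = n≤7
  ... | no n≰7 = contradiction (≤-trans (*-mono-≤ (≰⇒> n≰7) (s≤s (≰⇒> n≰7))) bound) (<⇒≱ (from-yes (59 <? 72)))

  3∣∧4∣⇒12∣ : ∀ {m} → 3 ∣ m → 4 ∣ m → 12 ∣ m
  3∣∧4∣⇒12∣ (divides a refl) 4∣3a with coprime-divisor {o = a} coprime[4,3] (subst (4 ∣_) (*-comm a 3) 4∣3a)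
    where
    coprime[4,3] : Coprime 4 3
    coprime[4,3] = from-yes (coprime? 4 3)
  ... | divides b refl = divides b (*-assoc b 4 3)

module SomborEdges {n : ℕ} (G : Graph n) where
  open import Data.Product using (_,_)
  open import Relation.Binary.PropositionalEquality as ≡ using (_≡_; refl; trans; cong; subst; subst₂)
  open SquarefreeParts using (IsSquare)
  open PythagoreanArithmetic
  open FinSums
  open EdgeSums G
  open import Data.Nat using (suc; _+_; _*_; _≡ᵇ_; z≤n)
  open import Data.Nat.Properties
  open import Data.Nat.Divisibility using (_∣_; *-monoʳ-∣)
  open import Data.Bool using (true; false)
  open import Data.Fin using (Fin; toℕ)
  open import Data.Fin.Properties using (toℕ-injective)
  open import Data.Sum using (_⊎_; inj₁; inj₂)
  open import Relation.Binary.Definitions using (tri<; tri≈; tri>)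
  open import Relation.Nullary using (contradiction)
  open import Algebra.Properties.Semiring.Sum +-*-semiring using (*-distribʳ-sum)

  weight : Fin n → Fin n → ℕ
  weight i j = degree G i * degree G i + degree G j * degree G j

  root : Fin n → Fin n → ℕ
  root i j = √ₙ (weight i j)

  root-sym : ∀ i j → root i j ≡ root j i
  root-sym i j = cong √ₙ (+-comm (degree G i * degree G i) _)

  module _ (squares : ∀ i j → IsArc i j → IsSquare (weight i j)) where

    adj⇒root² : ∀ {i j} → adj G i j ≡ true → root i j * root i j ≡ weight i j
    adj⇒root² {i} {j} ij with <-cmp (toℕ i) (toℕ j)
    ... | tri< i<j _ _ = √ₙ-square (squares i j (below≡true i<j , ij))
    ... | tri> _ _ j<i = subst₂ (λ r w → r * r ≡ w) (root-sym j i) (+-comm (degree G j * degree G j) _)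
                           (√ₙ-square (squares j i (below≡true j<i , trans (Graph.sym G j i) ij)))
    ... | tri≈ _ i≡j _ rewrite toℕ-injective i≡j = contradiction (trans (≡.sym ij) (Graph.irrefl G j)) (λ ())

    degree*[1+degree]≤ : ∀ i → degree G i * suc (degree G i) ≤ edgeSum root
    degree*[1+degree]≤ i = begin
      degree G i * suc (degree G i)                    ≡⟨ cong (_* suc (degree G i)) (degree≡∑adj i) ⟩
      (∑[ j < n ] 𝟙 (adj G i j)) * suc (degree G i)    ≡⟨ *-distribʳ-sum (suc (degree G i)) (λ j → 𝟙 (adj G i j)) ⟩
      ∑[ j < n ] (𝟙 (adj G i j) * suc (degree G i))    ≤⟨ ∑-mono-≤ (λ j → neighbour j (adj G i j) refl) ⟩
      ∑[ j < n ] (𝟙 (adj G i j) * root i j)            ≤⟨ incident≤edgeSum root root-sym i ⟩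
      edgeSum root                                      ∎
      where
      open ≤-Reasoning
      neighbour : ∀ j b → adj G i j ≡ b → 𝟙 b * suc (degree G i) ≤ 𝟙 b * root i j
      neighbour j false _ = z≤n
      neighbour j true ij = *-monoʳ-≤ 1 (leg<hypotenuse (adj⇒root² ij) (adj⇒degree≥1 (trans (Graph.sym G j i) ij)))

    -- With all degrees at most 7 every edge is a (3,4,5) triangle, so each
    -- of the degree classes 3 and 4 meets every edge exactly once.
    small-degrees⇒60∣ : (∀ i → degree G i ≤ 7) → 60 ∣ edgeSum root
    small-degrees⇒60∣ small = subst (60 ∣_) (≡.sym edgeSum≡5*edgeCount)
      (*-monoʳ-∣ 5 (3∣∧4∣⇒12∣ (degree-class-divides 3 λ i j ij → legs3-4⇒one-leg-is (legs ij) (inj₁ refl))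
                             (degree-class-divides 4 λ i j ij → legs3-4⇒one-leg-is (legs ij) (inj₂ refl))))
      where
      legs : ∀ {i j} → IsArc i j → Legs3-4 (degree G i) (degree G j)
      legs {i} {j} ij@(_ , a) = pythagorean-legs≤7 (small i) (small j) (adj⇒degree≥1 a)
        (adj⇒degree≥1 (trans (Graph.sym G j i) a)) (squares i j ij)
      edgeSum≡5*edgeCount : edgeSum root ≡ 5 * edgeCount
      edgeSum≡5*edgeCount = trans (edgeSum-cong (λ i j ij → legs3-4⇒hypotenuse≡5 (legs ij))) (edgeSum-scale 5 (λ _ _ → 1))

module EuclideanFieldProperties {c ℓ} (F : EuclideanField c ℓ) where
  open EuclideanField F public renaming (_<_ to infix 4 _<_; _≤_ to infix 4 _≤ᶠ_; sym to ≈-sym)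
  open import Algebra.Properties.Ring ring using (-‿distribˡ-*; -‿distribʳ-*; -‿involutive; -0#≈0#)
  open import Algebra.Properties.AbelianGroup +-abelianGroup using (⁻¹-∙-comm)
  open import Algebra.Properties.CommutativeSemigroup +-commutativeSemigroup using (interchange)
  open import Algebra.Solver.Ring.AlmostCommutativeRing using (fromCommutativeRing; _-Raw-AlmostCommutative⟶_)
  import Algebra.Solver.Ring as RingSolver
  open import Data.Nat as ℕ using (zero; suc)
  import Data.Nat.Properties as ℕ
  open import Data.Integer as ℤ using (ℤ; +_; -[1+_])
  import Data.Integer.Properties as ℤ
  open import Data.Sign as Sign using (Sign)
  open import Data.Maybe using (Maybe; just; nothing)
  open import Data.Product using (proj₁; proj₂)
  open import Data.Sum using (_⊎_; inj₁; inj₂)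
  open import Relation.Nullary using (Dec; yes; no; contradiction)
  open import Relation.Binary.PropositionalEquality as ≡ using (_≡_)
  open import Relation.Binary.Definitions using (tri<; tri≈; tri>)
  open import Relation.Binary.Structures using (IsStrictTotalOrder)
  open IsStrictTotalOrder <-isStrictTotalOrder using (compare)
    renaming (irrefl to <-irrefl; trans to <-trans; <-respʳ-≈ to <-respʳ-≈; <-respˡ-≈ to <-respˡ-≈)
  open import Relation.Binary.Reasoning.Setoid setoid

  ι-homo-+ : ∀ m n → ι (m ℕ.+ n) ≈ ι m + ι n
  ι-homo-+ zero n = ≈-sym (+-identityˡ (ι n))
  ι-homo-+ (suc m) n = trans (+-congˡ (ι-homo-+ m n)) (≈-sym (+-assoc 1# (ι m) (ι n)))

  ι-homo-* : ∀ m n → ι (m ℕ.* n) ≈ ι m * ι n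
  ι-homo-* zero n = ≈-sym (zeroˡ (ι n))
  ι-homo-* (suc m) n = begin
    ι (n ℕ.+ m ℕ.* n)     ≈⟨ ι-homo-+ n (m ℕ.* n) ⟩
    ι n + ι (m ℕ.* n)     ≈⟨ +-cong (≈-sym (*-identityˡ (ι n))) (ι-homo-* m n) ⟩
    1# * ι n + ι m * ι n  ≈⟨ distribʳ (ι n) 1# (ι m) ⟨
    (1# + ι m) * ι n      ∎

  -- Integer coefficients for the ring solver.
  ιℤ : ℤ → Carrier
  ιℤ (+ n) = ι n
  ιℤ -[1+ n ] = - ι (suc n)

  signed : Sign → Carrier → Carrier
  signed Sign.+ x = x
  signed Sign.- x = - x

  signed-cong : ∀ s {x y} → x ≈ y → signed s x ≈ signed s y
  signed-cong Sign.+ x≈y = x≈y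
  signed-cong Sign.- x≈y = -‿cong x≈y

  signed-* : ∀ s t x y → signed (s Sign.* t) (x * y) ≈ signed s x * signed t y
  signed-* Sign.+ Sign.+ x y = refl
  signed-* Sign.+ Sign.- x y = -‿distribʳ-* x y
  signed-* Sign.- Sign.+ x y = -‿distribˡ-* x y
  signed-* Sign.- Sign.- x y = begin
    x * y         ≈⟨ *-congʳ (-‿involutive x) ⟨
    - - x * y     ≈⟨ -‿distribˡ-* (- x) y ⟨
    - (- x * y)   ≈⟨ -‿distribʳ-* (- x) y ⟩
    - x * - y     ∎

  ιℤ-◃ : ∀ s n → ιℤ (s ℤ.◃ n) ≈ signed s (ι n)
  ιℤ-◃ Sign.+ zero = refl
  ιℤ-◃ Sign.- zero = ≈-sym -0#≈0#
  ιℤ-◃ Sign.+ (suc n) = refl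
  ιℤ-◃ Sign.- (suc n) = refl

  ιℤ-sign-abs : ∀ i → ιℤ i ≈ signed (ℤ.sign i) (ι ℤ.∣ i ∣)
  ιℤ-sign-abs (+ n) = refl
  ιℤ-sign-abs -[1+ n ] = refl

  ιℤ-homo-* : ∀ i j → ιℤ (i ℤ.* j) ≈ ιℤ i * ιℤ j
  ιℤ-homo-* i j = begin
    ιℤ (i ℤ.* j)                            ≈⟨ ιℤ-◃ (s Sign.* t) (ℤ.∣ i ∣ ℕ.* ℤ.∣ j ∣) ⟩
    signed (s Sign.* t) (ι (ℤ.∣ i ∣ ℕ.* ℤ.∣ j ∣)) ≈⟨ signed-cong (s Sign.* t) (ι-homo-* ℤ.∣ i ∣ ℤ.∣ j ∣) ⟩
    signed (s Sign.* t) (ι ℤ.∣ i ∣ * ι ℤ.∣ j ∣)  ≈⟨ signed-* s t _ _ ⟩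
    signed s (ι ℤ.∣ i ∣) * signed t (ι ℤ.∣ j ∣) ≈⟨ *-cong (ιℤ-sign-abs i) (ιℤ-sign-abs j) ⟨
    ιℤ i * ιℤ j                              ∎
    where
    s = ℤ.sign i
    t = ℤ.sign j

  ιℤ-⊖ : ∀ m n → ιℤ (m ℤ.⊖ n) ≈ ι m - ι n
  ιℤ-⊖ zero zero = ≈-sym (trans (+-congˡ -0#≈0#) (+-identityʳ 0#))
  ιℤ-⊖ zero (suc n) = ≈-sym (+-identityˡ _)
  ιℤ-⊖ (suc m) zero = ≈-sym (trans (+-congˡ -0#≈0#) (+-identityʳ _))
  ιℤ-⊖ (suc m) (suc n) = begin
    ιℤ (suc m ℤ.⊖ suc n)         ≡⟨ ≡.cong ιℤ (ℤ.[1+m]⊖[1+n]≡m⊖n m n) ⟩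
    ιℤ (m ℤ.⊖ n)                 ≈⟨ ιℤ-⊖ m n ⟩
    ι m - ι n                    ≈⟨ +-identityˡ _ ⟨
    0# + (ι m - ι n)             ≈⟨ +-congʳ (-‿inverseʳ 1#) ⟨
    (1# - 1#) + (ι m - ι n)      ≈⟨ interchange 1# (- 1#) (ι m) (- ι n) ⟩
    (1# + ι m) + (- 1# - ι n)    ≈⟨ +-congˡ (⁻¹-∙-comm 1# (ι n)) ⟩
    (1# + ι m) - (1# + ι n)      ∎

  ιℤ-homo-+ : ∀ i j → ιℤ (i ℤ.+ j) ≈ ιℤ i + ιℤ j
  ιℤ-homo-+ (+ m) (+ n) = ι-homo-+ m n
  ιℤ-homo-+ (+ m) -[1+ n ] = ιℤ-⊖ m (suc n)
  ιℤ-homo-+ -[1+ m ] (+ n) = trans (ιℤ-⊖ n (suc m)) (+-comm _ _)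
  ιℤ-homo-+ -[1+ m ] -[1+ n ] = begin
    - ι (suc (suc (m ℕ.+ n)))       ≡⟨ ≡.cong (λ k → - ι k) (≡.cong suc (≡.sym (ℕ.+-suc m n))) ⟩
    - ι (suc m ℕ.+ suc n)           ≈⟨ -‿cong (ι-homo-+ (suc m) (suc n)) ⟩
    - (ι (suc m) + ι (suc n))       ≈⟨ ⁻¹-∙-comm _ _ ⟨
    - ι (suc m) + - ι (suc n)       ∎

  ιℤ-homo-- : ∀ i → ιℤ (ℤ.- i) ≈ - ιℤ i
  ιℤ-homo-- (+ zero) = ≈-sym -0#≈0#
  ιℤ-homo-- (+ suc n) = refl
  ιℤ-homo-- -[1+ n ] = ≈-sym (-‿involutive _)

  ιℤ-square : ∀ z → ιℤ z * ιℤ z ≈ ι (ℤ.∣ z ∣ ℕ.* ℤ.∣ z ∣)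
  ιℤ-square (+ n) = ≈-sym (ι-homo-* n n)
  ιℤ-square -[1+ n ] = ≈-sym (trans (ι-homo-* (suc n) (suc n)) (signed-* Sign.- Sign.- _ _))

  ιℤ-homomorphism : ℤ.+-*-rawRing -Raw-AlmostCommutative⟶ fromCommutativeRing commRing
  ιℤ-homomorphism = record
    { ⟦_⟧ = ιℤ ; +-homo = ιℤ-homo-+ ; *-homo = ιℤ-homo-* ; -‿homo = ιℤ-homo--
    ; 0-homo = refl ; 1-homo = +-identityʳ 1# }

  ιℤ-≟ : ∀ i j → Maybe (ιℤ i ≈ ιℤ j)
  ιℤ-≟ i j with i ℤ.≟ j
  ... | yes i≡j = just (reflexive (≡.cong ιℤ i≡j))
  ... | no _ = nothing

  open RingSolver ℤ.+-*-rawRing (fromCommutativeRing commRing) ιℤ-homomorphism ιℤ-≟ public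
    using (solve; _:=_; _:+_; _:*_; _:-_; :-_; con)

  <-resp-≈ : ∀ {x x′ y y′} → x ≈ x′ → y ≈ y′ → x < y → x′ < y′
  <-resp-≈ x≈x′ y≈y′ x<y = <-respˡ-≈ x≈x′ (<-respʳ-≈ y≈y′ x<y)

  <⇒≉ : ∀ {x y} → x < y → ¬ (x ≈ y)
  <⇒≉ x<y x≈y = <-irrefl x≈y x<y

  0<⇒≉0 : ∀ {x} → 0# < x → ¬ (x ≈ 0#)
  0<⇒≉0 0<x x≈0 = <⇒≉ 0<x (≈-sym x≈0)

  +-monoʳ-< : ∀ {x y} z → x < y → z + x < z + y
  +-monoʳ-< {x} {y} z x<y = <-resp-≈ (+-comm x z) (+-comm y z) (+-mono-< z x<y)

  x<0⇒0<-x : ∀ {x} → x < 0# → 0# < - x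
  x<0⇒0<-x {x} x<0 = <-resp-≈ (-‿inverseʳ x) (+-identityˡ (- x)) (+-mono-< (- x) x<0)

  +-pos-nonneg : ∀ {x y} → 0# < x → 0# ≤ᶠ y → 0# < x + y
  +-pos-nonneg {x} 0<x (inj₁ 0<y) = <-trans 0<x (<-resp-≈ (+-identityʳ x) refl (+-monoʳ-< x 0<y))
  +-pos-nonneg {x} 0<x (inj₂ 0≈y) = <-resp-≈ refl (trans (≈-sym (+-identityʳ x)) (+-congˡ 0≈y)) 0<x

  +-nonneg : ∀ {x y} → 0# ≤ᶠ x → 0# ≤ᶠ y → 0# ≤ᶠ x + y
  +-nonneg (inj₁ 0<x) 0≤y = inj₁ (+-pos-nonneg 0<x 0≤y)
  +-nonneg {x} {y} (inj₂ 0≈x) (inj₁ 0<y) = inj₁ (<-resp-≈ refl (trans (≈-sym (+-identityˡ y)) (+-congʳ 0≈x)) 0<y)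
  +-nonneg (inj₂ 0≈x) (inj₂ 0≈y) = inj₂ (trans (≈-sym (+-identityˡ 0#)) (+-cong 0≈x 0≈y))

  *-nonneg : ∀ {x y} → 0# ≤ᶠ x → 0# ≤ᶠ y → 0# ≤ᶠ x * y
  *-nonneg (inj₁ 0<x) (inj₁ 0<y) = inj₁ (*-pos 0<x 0<y)
  *-nonneg {x} (inj₁ _) (inj₂ 0≈y) = inj₂ (trans (≈-sym (zeroʳ x)) (*-congˡ 0≈y))
  *-nonneg {y = y} (inj₂ 0≈x) _ = inj₂ (trans (≈-sym (zeroˡ y)) (*-congʳ 0≈x))

  x*x-nonneg : ∀ x → 0# ≤ᶠ x * x
  x*x-nonneg x with compare 0# x
  ... | tri< 0<x _ _ = inj₁ (*-pos 0<x 0<x)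
  ... | tri≈ _ 0≈x _ = inj₂ (trans (≈-sym (zeroˡ x)) (*-congʳ 0≈x))
  ... | tri> _ _ x<0 = inj₁ (<-resp-≈ refl (-x*-x≈x*x x) (*-pos (x<0⇒0<-x x<0) (x<0⇒0<-x x<0)))
    where
    -x*-x≈x*x : ∀ x → - x * - x ≈ x * x
    -x*-x≈x*x x = ≈-sym (signed-* Sign.- Sign.- x x)

  ι-nonneg : ∀ n → 0# ≤ᶠ ι n
  ι-nonneg zero = inj₂ refl
  ι-nonneg (suc n) = inj₁ (+-pos-nonneg 0<1 (ι-nonneg n))

  ι-pos : ∀ {n} → 1 ≤ n → 0# < ι n
  ι-pos {suc n} _ = +-pos-nonneg 0<1 (ι-nonneg n)

  ι-mono-< : ∀ {m n} → m ℕ.< n → ι m < ι n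
  ι-mono-< {m} {n} m<n = <-resp-≈ (+-identityʳ (ι m)) ι[m+k]≈ιn (+-monoʳ-< (ι m) (ι-pos {n ℕ.∸ m} (ℕ.m<n⇒0<n∸m m<n)))
    where
    ι[m+k]≈ιn : ι m + ι (n ℕ.∸ m) ≈ ι n
    ι[m+k]≈ιn = trans (≈-sym (ι-homo-+ m (n ℕ.∸ m))) (reflexive (≡.cong ι (ℕ.m+[n∸m]≡n (ℕ.<⇒≤ m<n))))

  ι-injective : ∀ {m n} → ι m ≈ ι n → m ≡ n
  ι-injective {m} {n} ιm≈ιn with ℕ.<-cmp m n
  ... | tri< m<n _ _ = contradiction ιm≈ιn (<⇒≉ (ι-mono-< m<n))
  ... | tri≈ _ m≡n _ = m≡n
  ... | tri> _ _ n<m = contradiction (≈-sym ιm≈ιn) (<⇒≉ (ι-mono-< n<m))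

  _≈0? : ∀ x → Dec (x ≈ 0#)
  x ≈0? with compare x 0#
  ... | tri< x<0 _ _ = no (<⇒≉ x<0)
  ... | tri≈ _ x≈0 _ = yes x≈0
  ... | tri> _ _ 0<x = no (0<⇒≉0 0<x)

  x*y≈0⇒x≈0⊎y≈0 : ∀ {x y} → x * y ≈ 0# → x ≈ 0# ⊎ y ≈ 0#
  x*y≈0⇒x≈0⊎y≈0 {x} {y} xy≈0 with x ≈0?
  ... | yes x≈0 = inj₁ x≈0
  ... | no x≉0 = inj₂ (begin
    y                ≈⟨ *-identityˡ y ⟨
    1# * y           ≈⟨ *-congʳ (proj₂ (inverse x x≉0)) ⟨
    (x * x⁻¹) * y    ≈⟨ solve 3 (λ x x⁻¹ y → (x :* x⁻¹) :* y := x⁻¹ :* (x :* y)) refl x x⁻¹ y ⟩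
    x⁻¹ * (x * y)    ≈⟨ *-congˡ xy≈0 ⟩
    x⁻¹ * 0#         ≈⟨ zeroʳ x⁻¹ ⟩
    0#               ∎)
    where x⁻¹ = proj₁ (inverse x x≉0)

  *-≉0 : ∀ {x y} → ¬ (x ≈ 0#) → ¬ (y ≈ 0#) → ¬ (x * y ≈ 0#)
  *-≉0 x≉0 y≉0 xy≈0 with x*y≈0⇒x≈0⊎y≈0 xy≈0
  ... | inj₁ x≈0 = x≉0 x≈0
  ... | inj₂ y≈0 = y≉0 y≈0

  t²≈s²⇒t≈±s : ∀ {t s} → t * t ≈ s * s → t ≈ s ⊎ t ≈ - s
  t²≈s²⇒t≈±s {t} {s} t²≈s² with x*y≈0⇒x≈0⊎y≈0 {t - s} {t + s} difference-of-squares
    where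
    difference-of-squares : (t - s) * (t + s) ≈ 0#
    difference-of-squares = begin
      (t - s) * (t + s)  ≈⟨ solve 2 (λ t s → (t :- s) :* (t :+ s) := t :* t :- s :* s) refl t s ⟩
      t * t - s * s      ≈⟨ +-congʳ t²≈s² ⟩
      s * s - s * s      ≈⟨ -‿inverseʳ (s * s) ⟩
      0#                 ∎
  ... | inj₁ t-s≈0 = inj₁ (trans (solve 2 (λ t s → t := (t :- s) :+ s) refl t s) (trans (+-congʳ t-s≈0) (+-identityˡ s)))
  ... | inj₂ t+s≈0 = inj₂ (trans (solve 2 (λ t s → t := (t :+ s) :- s) refl t s) (trans (+-congʳ t+s≈0) (+-identityˡ (- s))))

  square-injective : ∀ {x y} → 0# ≤ᶠ x → 0# ≤ᶠ y → x * x ≈ y * y → x ≈ y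
  square-injective {x} {y} 0≤x 0≤y x²≈y² with t²≈s²⇒t≈±s x²≈y²
  ... | inj₁ x≈y = x≈y
  ... | inj₂ x≈-y with 0≤x
  ...   | inj₁ 0<x = contradiction x+y≈0 (0<⇒≉0 (+-pos-nonneg 0<x 0≤y))
    where x+y≈0 = trans (+-congʳ x≈-y) (trans (+-comm (- y) y) (-‿inverseʳ y))
  ...   | inj₂ 0≈x = trans (≈-sym 0≈x) (≈-sym y≈0)
    where y≈0 = trans (≈-sym (-‿involutive y)) (trans (-‿cong (≈-sym x≈-y)) (trans (-‿cong (≈-sym 0≈x)) -0#≈0#))

  sqrt-cong : ∀ {x y} → 0# ≤ᶠ x → x ≈ y → sqrt x ≈ sqrt y
  sqrt-cong {x} {y} 0≤x x≈y = square-injective (sqrt-nonneg x) (sqrt-nonneg y)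
    (trans (sqrt-sq x 0≤x) (trans x≈y (≈-sym (sqrt-sq y (0≤y 0≤x)))))
    where
    0≤y : 0# ≤ᶠ x → 0# ≤ᶠ y
    0≤y (inj₁ 0<x) = inj₁ (<-resp-≈ refl x≈y 0<x)
    0≤y (inj₂ 0≈x) = inj₂ (trans 0≈x x≈y)

  sqrt-square : ∀ {x} → 0# ≤ᶠ x → sqrt (x * x) ≈ x
  sqrt-square {x} 0≤x = square-injective (sqrt-nonneg _) 0≤x (sqrt-sq (x * x) (x*x-nonneg x))

  sqrt-* : ∀ {x y} → 0# ≤ᶠ x → 0# ≤ᶠ y → sqrt (x * y) ≈ sqrt x * sqrt y
  sqrt-* {x} {y} 0≤x 0≤y = square-injective (sqrt-nonneg _) (*-nonneg (sqrt-nonneg x) (sqrt-nonneg y)) (begin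
    sqrt (x * y) * sqrt (x * y)              ≈⟨ sqrt-sq (x * y) (*-nonneg 0≤x 0≤y) ⟩
    x * y                                    ≈⟨ *-cong (sqrt-sq x 0≤x) (sqrt-sq y 0≤y) ⟨
    (sqrt x * sqrt x) * (sqrt y * sqrt y)    ≈⟨ solve 2 (λ a b → (a :* a) :* (b :* b) := (a :* b) :* (a :* b)) refl (sqrt x) (sqrt y) ⟩
    (sqrt x * sqrt y) * (sqrt x * sqrt y)    ∎)

  sqrt-pos : ∀ {x} → 0# < x → 0# < sqrt x
  sqrt-pos {x} 0<x with sqrt-nonneg x
  ... | inj₁ 0<√x = 0<√x
  ... | inj₂ 0≈√x = contradiction (trans (≈-sym (sqrt-sq x (inj₁ 0<x))) (trans (*-congʳ (≈-sym 0≈√x)) (zeroˡ _))) (0<⇒≉0 0<x)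

  √ι : ℕ → Carrier
  √ι n = sqrt (ι n)

  √ι-square : ∀ s → √ι (s ℕ.* s) ≈ ι s
  √ι-square s = trans (sqrt-cong (ι-nonneg (s ℕ.* s)) (ι-homo-* s s)) (sqrt-square (ι-nonneg s))

  √ι-* : ∀ m n → √ι (m ℕ.* n) ≈ √ι m * √ι n
  √ι-* m n = trans (sqrt-cong (ι-nonneg (m ℕ.* n)) (ι-homo-* m n)) (sqrt-* (ι-nonneg m) (ι-nonneg n))

module MultiquadraticFields {c ℓ} (F : EuclideanField c ℓ) where
  open EuclideanFieldProperties F
  open import Algebra.Properties.Ring ring using (-‿distribˡ-*; -‿distribʳ-*; -‿involutive)
  open SquarefreeParts using (squarefree*square≢square)
  open import Level using (_⊔_)
  open import Data.Nat as ℕ using (zero; suc; s≤s; z≤n)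
  import Data.Nat.Properties as ℕ
  open import Data.Nat.Primality using (Prime)
  open import Data.Nat.ListAction using (product)
  open import Data.Integer as ℤ using (ℤ; +_; -[1+_])
  open import Data.List using (List; []; _∷_)
  open import Data.List.Membership.Propositional using (_∈_; _∉_)
  open import Data.List.Relation.Unary.All using (All; []; _∷_)
  open import Data.List.Relation.Unary.All.Properties using (¬Any⇒All¬)
  open import Data.List.Relation.Unary.Any using (here; there)
  open import Data.List.Relation.Unary.Unique.Propositional using (Unique; []; _∷_)
  open import Data.List.Relation.Unary.Unique.Propositional.Properties using (Unique[x∷xs]⇒x∉xs)
  open import Data.List.Relation.Binary.Disjoint.Propositional using (Disjoint; contractᵣ)
  open import Data.Product using (_,_; proj₁; proj₂; ∃)
  open import Data.Sum using (_⊎_; inj₁; inj₂)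
  open import Relation.Nullary using (yes; no; contradiction)
  import Relation.Binary.PropositionalEquality as ≡
  open import Relation.Binary.Reasoning.Setoid setoid

  -- x ∈ℚ[√ q ∷ Q ] says x = α + β √q with α, β ∈ ℚ(√Q); a rational x = p/(n + 1) is given by p and n.
  infix 4 _∈ℚ[√_]
  data _∈ℚ[√_] : Carrier → List ℕ → Set (c ⊔ ℓ) where
    rational : ∀ {x} (p : ℤ) (n : ℕ) → x * ι (suc n) ≈ ιℤ p → x ∈ℚ[√ [] ]
    adjoin : ∀ {q Q x} α β → α ∈ℚ[√ Q ] → β ∈ℚ[√ Q ] → x ≈ α + β * √ι q → x ∈ℚ[√ q ∷ Q ]

  ∈ℚ-resp-≈ : ∀ {Q x y} → x ≈ y → x ∈ℚ[√ Q ] → y ∈ℚ[√ Q ]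
  ∈ℚ-resp-≈ x≈y (rational p n xN≈p) = rational p n (trans (*-congʳ (≈-sym x≈y)) xN≈p)
  ∈ℚ-resp-≈ x≈y (adjoin α β α∈ β∈ x≈) = adjoin α β α∈ β∈ (trans (≈-sym x≈y) x≈)

  ι∈ℚ : ∀ Q n → ι n ∈ℚ[√ Q ]
  ι∈ℚ [] n = rational (+ n) 0 (trans (*-congˡ (+-identityʳ 1#)) (*-identityʳ (ι n)))
  ι∈ℚ (q ∷ Q) n = adjoin (ι n) 0# (ι∈ℚ Q n) (ι∈ℚ Q 0) (≈-sym (trans (+-congˡ (zeroˡ _)) (+-identityʳ _)))

  1∈ℚ : ∀ Q → 1# ∈ℚ[√ Q ]
  1∈ℚ Q = ∈ℚ-resp-≈ (+-identityʳ 1#) (ι∈ℚ Q 1)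

  -‿∈ℚ : ∀ {Q x} → x ∈ℚ[√ Q ] → - x ∈ℚ[√ Q ]
  -‿∈ℚ {x = x} (rational p n xN≈p) =
    rational (ℤ.- p) n (trans (≈-sym (-‿distribˡ-* x _)) (trans (-‿cong xN≈p) (≈-sym (ιℤ-homo-- p))))
  -‿∈ℚ (adjoin α β α∈ β∈ x≈) = adjoin (- α) (- β) (-‿∈ℚ α∈) (-‿∈ℚ β∈)
    (trans (-‿cong x≈) (solve 3 (λ a b s → :- (a :+ b :* s) := (:- a) :+ (:- b) :* s) refl α β _))

  +-∈ℚ : ∀ {Q x y} → x ∈ℚ[√ Q ] → y ∈ℚ[√ Q ] → x + y ∈ℚ[√ Q ]
  +-∈ℚ {x = x} {y} (rational p₁ n₁ x≈) (rational p₂ n₂ y≈) =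
    rational (p₁ ℤ.* + suc n₂ ℤ.+ p₂ ℤ.* + suc n₁) (n₂ ℕ.+ n₁ ℕ.* suc n₂) (begin
      (x + y) * ι (suc n₁ ℕ.* suc n₂)    ≈⟨ *-congˡ (ι-homo-* (suc n₁) (suc n₂)) ⟩
      (x + y) * (N₁ * N₂)                 ≈⟨ solve 4 (λ x y a b → (x :+ y) :* (a :* b) := (x :* a) :* b :+ (y :* b) :* a) refl x y N₁ N₂ ⟩
      (x * N₁) * N₂ + (y * N₂) * N₁       ≈⟨ +-cong (*-congʳ x≈) (*-congʳ y≈) ⟩
      ιℤ p₁ * N₂ + ιℤ p₂ * N₁             ≈⟨ +-cong (ιℤ-homo-* p₁ (+ suc n₂)) (ιℤ-homo-* p₂ (+ suc n₁)) ⟨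
      ιℤ (p₁ ℤ.* + suc n₂) + ιℤ (p₂ ℤ.* + suc n₁) ≈⟨ ιℤ-homo-+ (p₁ ℤ.* + suc n₂) (p₂ ℤ.* + suc n₁) ⟨
      ιℤ (p₁ ℤ.* + suc n₂ ℤ.+ p₂ ℤ.* + suc n₁) ∎)
    where
    N₁ = ι (suc n₁)
    N₂ = ι (suc n₂)
  +-∈ℚ (adjoin α₁ β₁ α₁∈ β₁∈ x≈) (adjoin α₂ β₂ α₂∈ β₂∈ y≈) =
    adjoin (α₁ + α₂) (β₁ + β₂) (+-∈ℚ α₁∈ α₂∈) (+-∈ℚ β₁∈ β₂∈)
      (trans (+-cong x≈ y≈) (solve 5 (λ a₁ b₁ a₂ b₂ s → (a₁ :+ b₁ :* s) :+ (a₂ :+ b₂ :* s)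
                                           := (a₁ :+ a₂) :+ (b₁ :+ b₂) :* s) refl α₁ β₁ α₂ β₂ _))

  *-∈ℚ : ∀ {Q x y} → x ∈ℚ[√ Q ] → y ∈ℚ[√ Q ] → x * y ∈ℚ[√ Q ]
  *-∈ℚ {x = x} {y} (rational p₁ n₁ x≈) (rational p₂ n₂ y≈) =
    rational (p₁ ℤ.* p₂) (n₂ ℕ.+ n₁ ℕ.* suc n₂) (begin
      x * y * ι (suc n₁ ℕ.* suc n₂)       ≈⟨ *-congˡ (ι-homo-* (suc n₁) (suc n₂)) ⟩
      x * y * (N₁ * N₂)                   ≈⟨ solve 4 (λ x y a b → x :* y :* (a :* b) := (x :* a) :* (y :* b)) refl x y N₁ N₂ ⟩
      (x * N₁) * (y * N₂)                 ≈⟨ *-cong x≈ y≈ ⟩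
      ιℤ p₁ * ιℤ p₂                       ≈⟨ ιℤ-homo-* p₁ p₂ ⟨
      ιℤ (p₁ ℤ.* p₂)                      ∎)
    where
    N₁ = ι (suc n₁)
    N₂ = ι (suc n₂)
  *-∈ℚ {q ∷ Q} {x} {y} (adjoin α₁ β₁ α₁∈ β₁∈ x≈) (adjoin α₂ β₂ α₂∈ β₂∈ y≈) =
    adjoin (α₁ * α₂ + β₁ * β₂ * ι q) (α₁ * β₂ + β₁ * α₂)
      (+-∈ℚ (*-∈ℚ α₁∈ α₂∈) (*-∈ℚ (*-∈ℚ β₁∈ β₂∈) (ι∈ℚ Q q))) (+-∈ℚ (*-∈ℚ α₁∈ β₂∈) (*-∈ℚ β₁∈ α₂∈)) (begin
        x * y                                                     ≈⟨ *-cong x≈ y≈ ⟩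
        (α₁ + β₁ * s) * (α₂ + β₂ * s)                             ≈⟨ solve 5 (λ a₁ b₁ a₂ b₂ s → (a₁ :+ b₁ :* s) :* (a₂ :+ b₂ :* s)
                                                                     := a₁ :* a₂ :+ b₁ :* b₂ :* (s :* s) :+ (a₁ :* b₂ :+ b₁ :* a₂) :* s)
                                                                     refl α₁ β₁ α₂ β₂ s ⟩
        α₁ * α₂ + β₁ * β₂ * (s * s) + (α₁ * β₂ + β₁ * α₂) * s    ≈⟨ +-congʳ (+-congˡ (*-congˡ (sqrt-sq (ι q) (ι-nonneg q)))) ⟩
        α₁ * α₂ + β₁ * β₂ * ι q + (α₁ * β₂ + β₁ * α₂) * s        ∎)
    where s = √ι q

  ∈ℚ-weaken : ∀ {q Q x} → x ∈ℚ[√ Q ] → x ∈ℚ[√ q ∷ Q ]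
  ∈ℚ-weaken {Q = Q} {x} x∈ = adjoin x 0# x∈ (ι∈ℚ Q 0) (≈-sym (trans (+-congˡ (zeroˡ _)) (+-identityʳ x)))

  √∈ℚ : ∀ {q Q} → q ∈ Q → √ι q ∈ℚ[√ Q ]
  √∈ℚ {Q = q ∷ Q} (here ≡.refl) = adjoin 0# 1# (ι∈ℚ Q 0) (1∈ℚ Q) (≈-sym (trans (+-identityˡ _) (*-identityˡ _)))
  √∈ℚ (there q∈Q) = ∈ℚ-weaken (√∈ℚ q∈Q)

  √∏∈ℚ : ∀ {Q ps} → All (_∈ Q) ps → √ι (product ps) ∈ℚ[√ Q ]
  √∏∈ℚ {Q} [] = ∈ℚ-resp-≈ (≈-sym (√ι-square 1)) (ι∈ℚ Q 1)
  √∏∈ℚ {ps = r ∷ ps} (r∈Q ∷ ps⊆Q) = ∈ℚ-resp-≈ (≈-sym (√ι-* r (product ps))) (*-∈ℚ (√∈ℚ r∈Q) (√∏∈ℚ ps⊆Q))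

  InverseClosed : List ℕ → Set (c ⊔ ℓ)
  InverseClosed Q = ∀ {x} → x ∈ℚ[√ Q ] → ¬ x ≈ 0# → ∃ λ y → y ∈ℚ[√ Q ] × x * y ≈ 1#

  ExcludesSquarefreeRoots : List ℕ → Set (c ⊔ ℓ)
  ExcludesSquarefreeRoots Q = ∀ {p ps} → All Prime (p ∷ ps) → Unique (p ∷ ps) → Disjoint (p ∷ ps) Q →
                              ¬ √ι (product (p ∷ ps)) ∈ℚ[√ Q ]

  cancel-inverse : ∀ {x y b k} → x * y ≈ 1# → x * b ≈ k → y * k ≈ b
  cancel-inverse {x} {y} {b} {k} xy≈1 xb≈k = begin
    y * k        ≈⟨ *-congˡ xb≈k ⟨
    y * (x * b)  ≈⟨ solve 3 (λ x y b → y :* (x :* b) := (x :* y) :* b) refl x y b ⟩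
    (x * y) * b  ≈⟨ *-congʳ xy≈1 ⟩
    1# * b       ≈⟨ *-identityˡ b ⟩
    b            ∎

  ÷-∈ℚ : ∀ {Q t r s} → InverseClosed Q → t ∈ℚ[√ Q ] → ¬ t ≈ 0# → r ∈ℚ[√ Q ] → t * s ≈ r → s ∈ℚ[√ Q ]
  ÷-∈ℚ {r = r} {s} inv t∈ t≉0 r∈ ts≈r with inv t∈ t≉0
  ... | t⁻¹ , t⁻¹∈ , tt⁻¹≈1 = ∈ℚ-resp-≈ (trans (*-comm r t⁻¹) (cancel-inverse tt⁻¹≈1 ts≈r)) (*-∈ℚ r∈ t⁻¹∈)

  excludes-prime : ∀ {q Q} → ExcludesSquarefreeRoots Q → Prime q → q ∉ Q → ¬ √ι q ∈ℚ[√ Q ]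
  excludes-prime {q} excl q-prime q∉Q √q∈ =
    excl (q-prime ∷ []) ([] ∷ []) (λ { (here ≡.refl , q∈Q) → q∉Q q∈Q })
      (∈ℚ-resp-≈ (reflexive (≡.cong √ι (≡.sym (ℕ.*-identityʳ q)))) √q∈)

  inverse₀ : InverseClosed []
  inverse₀ {x} (rational (+ zero) n xN≈0) x≉0 = contradiction xN≈0 (*-≉0 x≉0 (0<⇒≉0 (ι-pos {suc n} (s≤s z≤n))))
  inverse₀ {x} (rational (+ suc k) n xN≈p) x≉0 with inverse x x≉0
  ... | x⁻¹ , xx⁻¹≈1 = x⁻¹ , rational (+ suc n) k (cancel-inverse xx⁻¹≈1 xN≈p) , xx⁻¹≈1
  inverse₀ {x} (rational -[1+ k ] n xN≈p) x≉0 with inverse x x≉0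
  ... | x⁻¹ , xx⁻¹≈1 = x⁻¹ , rational -[1+ n ] k (begin
    x⁻¹ * ι (suc k)         ≈⟨ -‿involutive _ ⟨
    - - (x⁻¹ * ι (suc k))   ≈⟨ -‿cong (-‿distribʳ-* x⁻¹ (ι (suc k))) ⟩
    - (x⁻¹ * - ι (suc k))   ≈⟨ -‿cong (cancel-inverse xx⁻¹≈1 xN≈p) ⟩
    - ι (suc n)             ∎) , xx⁻¹≈1

  excludes₀ : ExcludesSquarefreeRoots []
  excludes₀ {p} {ps} primes uniq _ (rational z n √mN≈z) =
    squarefree*square≢square (suc n) ℤ.∣ z ∣ primes (Unique[x∷xs]⇒x∉xs uniq) (λ ()) (ι-injective (begin
      ι (m ℕ.* (suc n ℕ.* suc n))   ≈⟨ trans (ι-homo-* m _) (*-congˡ (ι-homo-* (suc n) (suc n))) ⟩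
      ι m * (N * N)                 ≈⟨ *-congʳ (sqrt-sq (ι m) (ι-nonneg m)) ⟨
      (√m * √m) * (N * N)           ≈⟨ solve 2 (λ a b → (a :* a) :* (b :* b) := (a :* b) :* (a :* b)) refl √m N ⟩
      (√m * N) * (√m * N)           ≈⟨ *-cong √mN≈z √mN≈z ⟩
      ιℤ z * ιℤ z                   ≈⟨ ιℤ-square z ⟩
      ι (ℤ.∣ z ∣ ℕ.* ℤ.∣ z ∣)       ∎))
    where
    m = product (p ∷ ps)
    √m = √ι m
    N = ι (suc n)

  module _ {q Q} (q-prime : Prime q) (q∉Q : q ∉ Q) (inv : InverseClosed Q) (excl : ExcludesSquarefreeRoots Q) where
    private
      s = √ι q
      s*s≈q : s * s ≈ ι q
      s*s≈q = sqrt-sq (ι q) (ι-nonneg q)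

    -- α² = β²q with β ≠ 0 would make √q = ±α/β rational over Q.
    norm≉0 : ∀ {α β} → α ∈ℚ[√ Q ] → β ∈ℚ[√ Q ] → ¬ β ≈ 0# → ¬ α * α - β * β * ι q ≈ 0#
    norm≉0 {α} {β} α∈ β∈ β≉0 N≈0 = excludes-prime excl q-prime q∉Q (÷-∈ℚ inv β∈ β≉0 (±α∈ (t²≈s²⇒t≈±s βs²≈α²)) refl)
      where
      βs²≈α² : (β * s) * (β * s) ≈ α * α
      βs²≈α² = begin
        (β * s) * (β * s)          ≈⟨ solve 2 (λ b s → (b :* s) :* (b :* s) := b :* b :* (s :* s)) refl β s ⟩
        β * β * (s * s)            ≈⟨ *-congˡ s*s≈q ⟩
        β * β * ι q                ≈⟨ +-identityˡ _ ⟨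
        0# + β * β * ι q           ≈⟨ +-congʳ N≈0 ⟨
        (α * α - β * β * ι q) + β * β * ι q ≈⟨ solve 2 (λ a b → (a :- b) :+ b := a) refl (α * α) (β * β * ι q) ⟩
        α * α                      ∎
      ±α∈ : β * s ≈ α ⊎ β * s ≈ - α → (β * s) ∈ℚ[√ Q ]
      ±α∈ (inj₁ βs≈α) = ∈ℚ-resp-≈ (≈-sym βs≈α) α∈
      ±α∈ (inj₂ βs≈-α) = ∈ℚ-resp-≈ (≈-sym βs≈-α) (-‿∈ℚ α∈)

    β≈0⇒x≈α : ∀ {x α β} → x ≈ α + β * s → β ≈ 0# → x ≈ α
    β≈0⇒x≈α {α = α} x≈ β≈0 = trans x≈ (trans (+-congˡ (trans (*-congʳ β≈0) (zeroˡ s))) (+-identityʳ α))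

    -- The inverse of α + β√q is (α - β√q) / (α² - β²q).
    inverse-step : InverseClosed (q ∷ Q)
    inverse-step {x} (adjoin α β α∈ β∈ x≈) x≉0 with β ≈0?
    ... | yes β≈0 = weaken (inv α∈ (λ α≈0 → x≉0 (trans (β≈0⇒x≈α x≈ β≈0) α≈0)))
      where
      weaken : (∃ λ y → y ∈ℚ[√ Q ] × α * y ≈ 1#) → ∃ λ y → y ∈ℚ[√ q ∷ Q ] × x * y ≈ 1#
      weaken (y , y∈ , αy≈1) = y , ∈ℚ-weaken y∈ , trans (*-congʳ (β≈0⇒x≈α x≈ β≈0)) αy≈1
    ... | no β≉0 = conjugate (inv N∈ (norm≉0 α∈ β∈ β≉0))
      where
      N∈ = +-∈ℚ (*-∈ℚ α∈ α∈) (-‿∈ℚ (*-∈ℚ (*-∈ℚ β∈ β∈) (ι∈ℚ Q q)))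
      conjugate : (∃ λ N⁻¹ → N⁻¹ ∈ℚ[√ Q ] × (α * α - β * β * ι q) * N⁻¹ ≈ 1#) → ∃ λ y → y ∈ℚ[√ q ∷ Q ] × x * y ≈ 1#
      conjugate (N⁻¹ , N⁻¹∈ , NN⁻¹≈1) =
        α * N⁻¹ + (- β * N⁻¹) * s , adjoin (α * N⁻¹) (- β * N⁻¹) (*-∈ℚ α∈ N⁻¹∈) (*-∈ℚ (-‿∈ℚ β∈) N⁻¹∈) refl , (begin
          x * (α * N⁻¹ + (- β * N⁻¹) * s)               ≈⟨ *-congʳ x≈ ⟩
          (α + β * s) * (α * N⁻¹ + (- β * N⁻¹) * s)     ≈⟨ solve 4 (λ a b n s → (a :+ b :* s) :* (a :* n :+ ((:- b) :* n) :* s)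
                                                                  := (a :* a :- b :* b :* (s :* s)) :* n) refl α β N⁻¹ s ⟩
          (α * α - β * β * (s * s)) * N⁻¹               ≈⟨ *-congʳ (+-congˡ (-‿cong (*-congˡ s*s≈q))) ⟩
          (α * α - β * β * ι q) * N⁻¹                   ≈⟨ NN⁻¹≈1 ⟩
          1#                                            ∎)

    -- Write √m = α + β√q.  If β = 0 then √m ∈ ℚ(√Q); if α = 0 then √(qm) = βq ∈ ℚ(√Q);
    -- otherwise squaring gives √q = (m - α² - β²q) / 2αβ ∈ ℚ(√Q).
    excludes-step : ExcludesSquarefreeRoots (q ∷ Q)
    excludes-step {p} {ps} primes uniq disj (adjoin α β α∈ β∈ √m≈) with β ≈0? | α ≈0?
    ... | yes β≈0 | _ = excl primes uniq (contractᵣ disj) (∈ℚ-resp-≈ (≈-sym (β≈0⇒x≈α √m≈ β≈0)) α∈)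
    ... | no β≉0 | yes α≈0 = excl (q-prime ∷ primes) (¬Any⇒All¬ (p ∷ ps) (λ q∈ → disj (q∈ , here ≡.refl)) ∷ uniq) disj′
                               (∈ℚ-resp-≈ βq≈√qm (*-∈ℚ β∈ (ι∈ℚ Q q)))
      where
      m = product (p ∷ ps)
      disj′ : Disjoint (q ∷ p ∷ ps) Q
      disj′ (here ≡.refl , q∈Q) = q∉Q q∈Q
      disj′ (there v∈ , v∈Q) = disj (v∈ , there v∈Q)
      βq≈√qm : β * ι q ≈ √ι (q ℕ.* m)
      βq≈√qm = ≈-sym (begin
        √ι (q ℕ.* m)         ≈⟨ √ι-* q m ⟩
        s * √ι m             ≈⟨ *-congˡ (trans √m≈ (+-congʳ α≈0)) ⟩
        s * (0# + β * s)     ≈⟨ solve 2 (λ s b → s :* (con (+ 0) :+ b :* s) := b :* (s :* s)) refl s β ⟩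
        β * (s * s)          ≈⟨ *-congˡ s*s≈q ⟩
        β * ι q              ∎)
    ... | no β≉0 | no α≉0 = excludes-prime excl q-prime q∉Q (÷-∈ℚ inv T∈ T≉0 R∈ Ts≈R)
      where
      m = product (p ∷ ps)
      T = ι 2 * (α * β)
      T∈ = *-∈ℚ (ι∈ℚ Q 2) (*-∈ℚ α∈ β∈)
      T≉0 = *-≉0 (0<⇒≉0 (ι-pos {2} (s≤s z≤n))) (*-≉0 α≉0 β≉0)
      A = α * α + β * β * ι q
      R∈ = +-∈ℚ (ι∈ℚ Q m) (-‿∈ℚ (+-∈ℚ (*-∈ℚ α∈ α∈) (*-∈ℚ (*-∈ℚ β∈ β∈) (ι∈ℚ Q q))))
      m≈A+Ts : ι m ≈ A + T * s
      m≈A+Ts = begin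
        ι m                                  ≈⟨ sqrt-sq (ι m) (ι-nonneg m) ⟨
        √ι m * √ι m                          ≈⟨ *-cong √m≈ √m≈ ⟩
        (α + β * s) * (α + β * s)            ≈⟨ solve 3 (λ a b s → (a :+ b :* s) :* (a :+ b :* s)
                                                           := a :* a :+ b :* b :* (s :* s) :+ con (+ 2) :* (a :* b) :* s) refl α β s ⟩
        α * α + β * β * (s * s) + T * s      ≈⟨ +-congʳ (+-congˡ (*-congˡ s*s≈q)) ⟩
        A + T * s                            ∎
      Ts≈R : T * s ≈ ι m - A
      Ts≈R = trans (solve 2 (λ a x → x := (a :+ x) :- a) refl A (T * s)) (+-congʳ (≈-sym m≈A+Ts))

  tower : ∀ Q → Unique Q → All Prime Q → InverseClosed Q × ExcludesSquarefreeRoots Q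
  tower [] _ _ = inverse₀ , excludes₀
  tower (q ∷ Q) uniq@(_ ∷ uniqQ) (q-prime ∷ primes) =
    inverse-step q-prime q∉Q (proj₁ IH) (proj₂ IH) , excludes-step q-prime q∉Q (proj₁ IH) (proj₂ IH)
    where
    q∉Q = Unique[x∷xs]⇒x∉xs uniq
    IH = tower Q uniqQ primes

module PrimesBelow where
  open import Data.Nat using (_<_; _≟_)
  open import Data.Nat.Primality using (Prime; prime?)
  open import Data.List using (List; upTo; filter)
  open import Data.List.Membership.Propositional using (_∈_; _∉_)
  open import Data.List.Membership.Propositional.Properties using (∈-filter⁺; ∈-filter⁻; ∈-upTo⁺)
  open import Data.List.Relation.Unary.All as All using (All)
  open import Data.List.Relation.Unary.Unique.Propositional using (Unique)
  open import Data.List.Relation.Unary.Unique.Propositional.Properties using (filter⁺; upTo⁺)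
  open import Data.Product using (_,_; proj₁; proj₂)
  open import Relation.Binary.PropositionalEquality using (_≢_; refl)
  open import Relation.Nullary using (Dec; ¬?)
  open import Relation.Nullary.Decidable using (_×-dec_)

  primeOtherThan? : ∀ p r → Dec (Prime r × p ≢ r)
  primeOtherThan? p r = prime? r ×-dec ¬? (p ≟ r)

  primesBelowExcept : ℕ → ℕ → List ℕ
  primesBelowExcept n p = filter (primeOtherThan? p) (upTo n)

  module _ {n p : ℕ} where
    primesBelowExcept-unique : Unique (primesBelowExcept n p)
    primesBelowExcept-unique = filter⁺ (primeOtherThan? p) (upTo⁺ n)

    primesBelowExcept-prime : All Prime (primesBelowExcept n p)
    primesBelowExcept-prime = All.tabulate (λ r∈ → proj₁ (proj₂ (∈-filter⁻ (primeOtherThan? p) {xs = upTo n} r∈)))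

    primesBelowExcept-∌ : p ∉ primesBelowExcept n p
    primesBelowExcept-∌ p∈ = proj₂ (proj₂ (∈-filter⁻ (primeOtherThan? p) {xs = upTo n} p∈)) refl

    primesBelowExcept-complete : ∀ {r} → Prime r → r < n → p ≢ r → r ∈ primesBelowExcept n p
    primesBelowExcept-complete r-prime r<n p≢r = ∈-filter⁺ (primeOtherThan? p) (∈-upTo⁺ r<n) (r-prime , p≢r)

module IntegralSumsOfSquareRoots {c ℓ} (F : EuclideanField c ℓ) where
  open EuclideanFieldProperties F
  open MultiquadraticFields F
  open SquarefreeParts
  open PrimesBelow
  open import Level using (_⊔_)
  open import Data.Nat as ℕ using (zero; suc; _≟_; s≤s; z≤n)
  import Data.Nat.Properties as ℕ
  open import Data.Nat.Primality using (Prime; productOfPrimes≥1)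
  open import Data.Nat.ListAction using (sum; product)
  open import Data.List using (List; []; _∷_; map)
  open import Data.List.Membership.Propositional using (_∈_; _∉_)
  open import Data.List.Membership.Propositional.Properties using (∈-filter⁻)
  open import Data.List.Membership.DecPropositional _≟_ using (_∈?_)
  open import Data.List.Relation.Unary.All as All using (All; []; _∷_)
  open import Data.List.Relation.Unary.Any using (here; there)
  open import Data.Product using (_,_; proj₁; proj₂)
  open import Data.Sum using (inj₂)
  open import Function using (_∘_)
  open import Data.Integer using (+_)
  open import Relation.Nullary using (yes; no; contradiction)
  open import Relation.Binary.PropositionalEquality as ≡ using (_≢_)
  open import Relation.Binary.Reasoning.Setoid setoid

  record SplitBy√ (p : ℕ) (Q : List ℕ) (P : Carrier → Set ℓ) (x : Carrier) : Set (c ⊔ ℓ) where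
    constructor split
    field
      A B : Carrier
      A∈ : A ∈ℚ[√ Q ]
      B∈ : B ∈ℚ[√ Q ]
      PB : P B
      x≈A+B√p : x ≈ A + B * √ι p

  module _ {p : ℕ} {Q : List ℕ} where

    split-+ : ∀ {P R S : Carrier → Set ℓ} {x y} → (∀ {a b} → P a → R b → S (a + b)) →
              SplitBy√ p Q P x → SplitBy√ p Q R y → SplitBy√ p Q S (x + y)
    split-+ P+R (split A₁ B₁ A₁∈ B₁∈ PB₁ x≈) (split A₂ B₂ A₂∈ B₂∈ RB₂ y≈) =
      split (A₁ + A₂) (B₁ + B₂) (+-∈ℚ A₁∈ A₂∈) (+-∈ℚ B₁∈ B₂∈) (P+R PB₁ RB₂)
        (trans (+-cong x≈ y≈) (solve 5 (λ a₁ b₁ a₂ b₂ s → (a₁ :+ b₁ :* s) :+ (a₂ :+ b₂ :* s)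
                                             := (a₁ :+ a₂) :+ (b₁ :+ b₂) :* s) refl A₁ B₁ A₂ B₂ (√ι p)))

    split-0 : SplitBy√ p Q (0# ≤ᶠ_) 0#
    split-0 = split 0# 0# (ι∈ℚ Q 0) (ι∈ℚ Q 0) (inj₂ refl) (≈-sym (trans (+-congˡ (zeroˡ _)) (+-identityʳ 0#)))

    split-Σ : ∀ {f : ℕ → Carrier} {W} → All (SplitBy√ p Q (0# ≤ᶠ_) ∘ f) W → SplitBy√ p Q (0# ≤ᶠ_) (Σ (map f W))
    split-Σ [] = split-0
    split-Σ (fw ∷ fW) = split-+ +-nonneg fw (split-Σ fW)

    split-Σ-strict : ∀ {f : ℕ → Carrier} {W w} → All (SplitBy√ p Q (0# ≤ᶠ_) ∘ f) W → w ∈ W →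
                     SplitBy√ p Q (0# <_) (f w) → SplitBy√ p Q (0# <_) (Σ (map f W))
    split-Σ-strict (_ ∷ fW) (here ≡.refl) fw = split-+ +-pos-nonneg fw (split-Σ fW)
    split-Σ-strict (fw′ ∷ fW) (there w∈W) fw =
      split-+ (λ 0≤a 0<b → <-resp-≈ refl (+-comm _ _) (+-pos-nonneg 0<b 0≤a)) fw′ (split-Σ-strict fW w∈W fw)

  Covers : List ℕ → ℕ → ℕ → Set
  Covers Q p b = ∀ {r} → Prime r → r ≤ b → p ≢ r → r ∈ Q

  module _ {p Q w} (D : SquarefreeForm w (λ q → Prime q × q ≤ w)) (covers : Covers Q p w) where
    open SquarefreeForm D

    rest : List ℕ
    rest = remove p core

    √w≈root*√∏core : √ι w ≈ ι root * √ι (product core)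
    √w≈root*√∏core = begin
      √ι w                                   ≡⟨ ≡.cong √ι w≡root²*∏core ⟩
      √ι (root ℕ.* root ℕ.* product core)    ≈⟨ √ι-* (root ℕ.* root) (product core) ⟩
      √ι (root ℕ.* root) * √ι (product core) ≈⟨ *-congʳ (√ι-square root) ⟩
      ι root * √ι (product core)             ∎

    rest⊆Q : All (_∈ Q) rest
    rest⊆Q = All.tabulate λ r∈ → let (r∈core , p≢r) = ∈-filter⁻ _ {xs = core} r∈
                                     (r-prime , r≤w) = All.lookup allP r∈core
                                 in covers r-prime r≤w p≢r

    √w≈B√p : p ∈ core → √ι w ≈ 0# + (ι root * √ι (product rest)) * √ι p
    √w≈B√p p∈core = begin
      √ι w                                        ≈⟨ √w≈root*√∏core ⟩
      ι root * √ι (product core)                  ≡⟨ ≡.cong (λ m → ι root * √ι m) (product-remove p∈core unique) ⟩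
      ι root * √ι (p ℕ.* product rest)            ≈⟨ *-congˡ (√ι-* p (product rest)) ⟩
      ι root * (√ι p * √ι (product rest))         ≈⟨ solve 3 (λ a s b → a :* (s :* b) := con (+ 0) :+ (a :* b) :* s)
                                                           refl (ι root) (√ι p) (√ι (product rest)) ⟩
      0# + (ι root * √ι (product rest)) * √ι p    ∎

    split-√ : SplitBy√ p Q (0# ≤ᶠ_) (√ι w)
    split-√ with p ∈? core
    ... | yes p∈core = split 0# (ι root * √ι (product rest)) (ι∈ℚ Q 0) (*-∈ℚ (ι∈ℚ Q root) (√∏∈ℚ rest⊆Q))
                         (*-nonneg (ι-nonneg root) (sqrt-nonneg _)) (√w≈B√p p∈core)
    ... | no p∉core = split (ι root * √ι (product core)) 0# (*-∈ℚ (ι∈ℚ Q root) (√∏∈ℚ core⊆Q)) (ι∈ℚ Q 0) (inj₂ refl)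
                         (trans √w≈root*√∏core (≈-sym (trans (+-congˡ (zeroˡ _)) (+-identityʳ _))))
      where
      core⊆Q : All (_∈ Q) core
      core⊆Q = All.tabulate λ {r} r∈core → covers (proj₁ (All.lookup allP r∈core)) (proj₂ (All.lookup allP r∈core))
                                              (λ { ≡.refl → p∉core r∈core })

    split-√-strict : p ∈ core → 1 ≤ root → SplitBy√ p Q (0# <_) (√ι w)
    split-√-strict p∈core 1≤root = split 0# (ι root * √ι (product rest)) (ι∈ℚ Q 0) (*-∈ℚ (ι∈ℚ Q root) (√∏∈ℚ rest⊆Q))
      (*-pos (ι-pos 1≤root) (sqrt-pos (ι-pos (productOfPrimes≥1 rest-prime)))) (√w≈B√p p∈core)
      where
      rest-prime : All Prime rest
      rest-prime = All.tabulate λ r∈ → proj₁ (All.lookup allP (proj₁ (∈-filter⁻ _ {xs = core} r∈)))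

  ∈⇒≤sum : ∀ {w W} → w ∈ W → w ≤ sum W
  ∈⇒≤sum {W = w ∷ W} (here ≡.refl) = ℕ.m≤m+n w (sum W)
  ∈⇒≤sum {W = v ∷ W} (there w∈W) = ℕ.≤-trans (∈⇒≤sum w∈W) (ℕ.m≤n+m (sum W) v)

  module _ (W : List ℕ) {k : ℕ} (Σ√W≈k : Σ (map √ι W) ≈ ι k) where

    -- Split every √w along a prime p of the square-free part of one of them:
    -- the √p-coefficient of the sum is then positive, so √p would lie in ℚ(√Q).
    prime∉core : ∀ {w} → w ∈ W → (D : SquarefreeForm w (λ q → Prime q × q ≤ w)) → 1 ≤ SquarefreeForm.root D →
                 ∀ {p} → p ∉ SquarefreeForm.core D
    prime∉core {w} w∈W D 1≤root {p} p∈core =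
      excludes-prime (proj₂ Q-tower) p-prime (primesBelowExcept-∌ {n})
        (÷-∈ℚ (proj₁ Q-tower) B∈ (0<⇒≉0 PB) k-A∈ B√p≈k-A)
      where
      n = suc (sum W)
      Q = primesBelowExcept n p
      Q-tower = tower Q (primesBelowExcept-unique {n} {p}) (primesBelowExcept-prime {n} {p})
      p-prime = proj₁ (All.lookup (SquarefreeForm.allP D) p∈core)
      covers : ∀ {v} → v ≤ sum W → Covers Q p v
      covers v≤ r-prime r≤v p≢r = primesBelowExcept-complete {n} r-prime (s≤s (ℕ.≤-trans r≤v v≤)) p≢r
      splits : All (SplitBy√ p Q (0# ≤ᶠ_) ∘ √ι) W
      splits = All.tabulate λ v∈ → split-√ (squarefreeForm _) (covers (∈⇒≤sum v∈))
      open SplitBy√ (split-Σ-strict splits w∈W (split-√-strict D (covers (∈⇒≤sum w∈W)) p∈core 1≤root))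
      k-A∈ : ι k - A ∈ℚ[√ Q ]
      k-A∈ = +-∈ℚ (ι∈ℚ Q k) (-‿∈ℚ A∈)
      B√p≈k-A : B * √ι p ≈ ι k - A
      B√p≈k-A = trans (solve 2 (λ a x → x := (a :+ x) :- a) refl A (B * √ι p))
                      (+-congʳ (trans (≈-sym x≈A+B√p) Σ√W≈k))

    integral⇒squares : All IsSquare W
    integral⇒squares = All.tabulate λ w∈W → square w∈W (squarefreeForm _)
      where
      square : ∀ {w} → w ∈ W → SquarefreeForm w (λ q → Prime q × q ≤ w) → IsSquare w
      square _ record { root = zero ; w≡root²*∏core = ≡.refl } = 0 , ≡.refl
      square _ record { root = suc r ; core = [] ; w≡root²*∏core = ≡.refl } = suc r , ≡.sym (ℕ.*-identityʳ _)
      square w∈W D@record { root = suc r ; core = p ∷ ps } = contradiction (here ≡.refl) (prime∉core w∈W D (s≤s z≤n))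

module SomborIndex {c ℓ} (F : EuclideanField c ℓ) where
  open EuclideanFieldProperties F
  open IntegralSumsOfSquareRoots F
  open SquarefreeParts using (IsSquare)
  open PythagoreanArithmetic using (√ₙ; √ₙ-square)
  open import Data.Nat.ListAction using (sum)
  open import Data.List using ([]; _∷_; map; replicate)
  open import Data.List.Relation.Unary.All using (All; []; _∷_)
  open import Data.List.Relation.Unary.All.Properties using (replicate⁺)
  open import Data.Product using (_,_)
  open import Relation.Binary.PropositionalEquality as ≡ using (_≡_)
  open import Relation.Binary.Reasoning.Setoid setoid

  Σ√ι-squares : ∀ {W} → All IsSquare W → Σ (map √ι W) ≈ ι (sum (map √ₙ W))
  Σ√ι-squares [] = refl
  Σ√ι-squares {w ∷ W} (w-square ∷ W-squares) =
    trans (+-cong √ι-w (Σ√ι-squares W-squares)) (≈-sym (ι-homo-+ (√ₙ w) (sum (map √ₙ W))))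
    where
    √ι-w : √ι w ≈ ι (√ₙ w)
    √ι-w = trans (reflexive (≡.cong √ι (≡.sym (√ₙ-square w-square)))) (√ι-square (√ₙ w))

  -- SO F K34 reduces to a sum of twelve copies of √25.
  SO[K34]≈60 : SO F K34 ≈ ι 60
  SO[K34]≈60 = Σ√ι-squares {replicate 12 25} (replicate⁺ 12 (5 , ≡.refl))

  module _ {n} (G : Graph n) where
    open EdgeSums G
    open SomborEdges G

    SO≡Σ√weights : SO F G ≡ Σ (map √ι (edgeList weight))
    SO≡Σ√weights = ≡.cong Σ (≡.sym (map-edgeList √ι weight))

    integral-SO : ∀ {k} → SO F G ≈ ι k → (∀ i j → IsArc i j → IsSquare (weight i j)) × k ≡ edgeSum root
    integral-SO {k} SO≈k = All-edgeList⁻ weight squares , ι-injective (begin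
      ι k                                   ≈⟨ trans (reflexive (≡.sym SO≡Σ√weights)) SO≈k ⟨
      Σ (map √ι (edgeList weight))          ≈⟨ Σ√ι-squares squares ⟩
      ι (sum (map √ₙ (edgeList weight)))    ≡⟨ ≡.cong (λ ws → ι (sum ws)) (map-edgeList √ₙ weight) ⟩
      ι (sum (edgeList root))               ≡⟨ ≡.cong ι (sum-edgeList root) ⟩
      ι (edgeSum root)                      ∎)
      where
      squares : All IsSquare (edgeList weight)
      squares = integral⇒squares (edgeList weight) {k} (trans (reflexive (≡.sym SO≡Σ√weights)) SO≈k)

open import Data.Nat using (s≤s; >-nonZero)
open import Data.Nat.Properties using (≤-trans; <⇒≱)
open import Data.Nat.Divisibility using (_∣_; ∣⇒≤)
open import Data.Product using (_,_; proj₁; proj₂)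
open import Relation.Binary.PropositionalEquality as ≡ using (subst)

corollary2p2 : ∀ {c ℓ} (F : EuclideanField c ℓ) →
    (∀ (n : ℕ) (G : Graph n) (k : ℕ) → 1 ≤ k → k ≤ 59 →
    ¬ (EuclideanField._≈_ F (SO F G) (EuclideanField.ι F k)))
    × EuclideanField._≈_ F (SO F K34) (EuclideanField.ι F 60)
corollary2p2 F = SO≉k≤59 , SomborIndex.SO[K34]≈60 F
  where
  SO≉k≤59 : ∀ n (G : Graph n) k → 1 ≤ k → k ≤ 59 → ¬ EuclideanField._≈_ F (SO F G) (EuclideanField.ι F k)
  SO≉k≤59 n G k 1≤k k≤59 SO≈k = <⇒≱ (s≤s k≤59) (∣⇒≤ {{>-nonZero 1≤k}} 60∣k)
    where
    open SomborEdges G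
    integral = SomborIndex.integral-SO F G {k} SO≈k
    squares = proj₁ integral
    k≡edgeSum = proj₂ integral
    degrees≤7 : ∀ i → degree G i ≤ 7
    degrees≤7 i = PythagoreanArithmetic.n*[1+n]≤59⇒n≤7
      (≤-trans (degree*[1+degree]≤ squares i) (subst (_≤ 59) k≡edgeSum k≤59))
    60∣k : 60 ∣ k
    60∣k = subst (60 ∣_) (≡.sym k≡edgeSum) (small-degrees⇒60∣ squares degrees≤7)
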